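{- Let $G$ be a finite simple graph. The following are equivalent: (i) $G$ is a König–Egerváry graph; (ii) $\operatorname{diadem}(G) = \operatorname{corona}(G)$; (iii) $|\operatorname{diadem}(G)| + |\operatorname{nucleus}(G)| = 2\alpha(G)$.
   Context: For $X\subseteq V(G)$, $N(X)=\bigcup_{u\in X}N(u)$ is the set of neighbors of $X$. A set is independent if no two of its vertices are adjacent; $\alpha(G)$ is the maximum size of an independent set (with $\alpha$ of the empty graph equal to $0$), and $\mu(G)$ is the maximum size of a matching. $G$ is a König–Egerváry graph if $\alpha(G)+\mu(G)=|V(G)|$; by convention the empty graph (no vertices) is König–Egerváry. $\operatorname{corona}(G)$ is the union of all maximum independent sets of $G$. The difference of $X\subseteq V(G)$ is $d(X)=|X|-|N(X)|$. An independent set $A$ is critical if $d(A)=\max\{d(Y): Y\subseteq V(G)\}$; this maximum equals the maximum of $d$ over independent sets, and the empty set may be critical. A maximum critical independent set is a critical independent set of maximum cardinality. $\operatorname{diadem}(G)$ is the union, and $\operatorname{nucleus}(G)$ the intersection, of all maximum critical independent sets of $G$. If the only critical independent set is $\emptyset$, both are empty. -}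

module Defs where

open import Data.Bool using (Bool; true; false; _∧_; _∨_; not)
open import Data.Nat using (ℕ; zero; suc; _+_; _⊔_; _≡ᵇ_; _≤ᵇ_)
open import Data.Integer as ℤ using (ℤ; +_; _-_)
open import Data.Fin using (Fin; _<_)
open import Data.Fin.Subset using (Subset; ∣_∣; inside; outside)
open import Data.List.Base as List using (List; []; _∷_; _++_; allFin; map; foldr; filter; length; concatMap)
open import Data.Bool using (T?)
open import Data.Bool.ListAction using (all; any)
open import Data.Vec as Vec using (Vec; lookup; tabulate)
open import Data.Product using (_×_; _,_)
open import Relation.Binary.PropositionalEquality using (_≡_)
open import Relation.Nullary.Decidable using (⌊_⌋)

record Graph (n : ℕ) : Set where
  field
    adj     : Fin n → Fin n → Bool
    adj-sym : ∀ u v → adj u v ≡ adj v u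
    adj-irr : ∀ u → adj u u ≡ false
open Graph public

_∈ᵇ_ : ∀ {n} → Fin n → Subset n → Bool
v ∈ᵇ S = lookup S v

allSubsets : ∀ n → List (Subset n)
allSubsets zero    = Vec.[] ∷ []
allSubsets (suc n) = map (outside Vec.∷_) (allSubsets n) ++ map (inside Vec.∷_) (allSubsets n)

sublists : ∀ {A : Set} → List A → List (List A)
sublists []       = [] ∷ []
sublists (x ∷ xs) = sublists xs ++ map (x ∷_) (sublists xs)

maxℕ : List ℕ → ℕ
maxℕ = foldr _⊔_ 0

maxℤ : List ℤ → ℤ
maxℤ = foldr ℤ._⊔_ (+ 0)

module _ {n : ℕ} (G : Graph n) where

  independent : Subset n → Bool
  independent S = all (λ u → all (λ v → not (u ∈ᵇ S ∧ v ∈ᵇ S ∧ adj G u v)) (allFin n)) (allFin n)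

  α : ℕ
  α = maxℕ (map ∣_∣ (filter (λ S → T? (independent S)) (allSubsets n)))

  edges : List (Fin n × Fin n)
  edges = concatMap (λ u → List.mapMaybe (λ v → edgeAt u v) (allFin n)) (allFin n)
    where
      open import Data.Maybe using (Maybe; just; nothing)
      edgeAt : Fin n → Fin n → Maybe (Fin n × Fin n)
      edgeAt u v with ⌊ u Data.Fin.<? v ⌋ ∧ adj G u v
      ... | true  = just (u , v)
      ... | false = nothing

  endpointOf : Fin n → Fin n × Fin n → Bool
  endpointOf w (u , v) = ⌊ w Data.Fin.≟ u ⌋ ∨ ⌊ w Data.Fin.≟ v ⌋

  isMatching : List (Fin n × Fin n) → Bool
  isMatching M = all (λ w → length (filter (λ e → T? (endpointOf w e)) M) ≤ᵇ 1) (allFin n)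

  μ : ℕ
  μ = maxℕ (map length (filter (λ M → T? (isMatching M)) (sublists edges)))

  KönigEgerváry : Set
  KönigEgerváry = α + μ ≡ n

  N : Subset n → Subset n
  N X = tabulate (λ v → any (λ u → u ∈ᵇ X ∧ adj G u v) (allFin n))

  d : Subset n → ℤ
  d X = + ∣ X ∣ - + ∣ N X ∣

  dmax : ℤ
  dmax = maxℤ (map d (allSubsets n))

  criticalIndependent : Subset n → Bool
  criticalIndependent A = independent A ∧ ⌊ d A ℤ.≟ dmax ⌋

  maxCritSize : ℕ
  maxCritSize = maxℕ (map ∣_∣ (filter (λ S → T? (criticalIndependent S)) (allSubsets n)))

  maxCriticalIndependent : Subset n → Bool
  maxCriticalIndependent S = criticalIndependent S ∧ (∣ S ∣ ≡ᵇ maxCritSize)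

  maxIndependent : Subset n → Bool
  maxIndependent S = independent S ∧ (∣ S ∣ ≡ᵇ α)

  corona : Subset n
  corona = tabulate (λ v → any (λ S → maxIndependent S ∧ v ∈ᵇ S) (allSubsets n))

  diadem : Subset n
  diadem = tabulate (λ v → any (λ S → maxCriticalIndependent S ∧ v ∈ᵇ S) (allSubsets n))

  nucleus : Subset n
  nucleus = tabulate (λ v → all (λ S → not (maxCriticalIndependent S) ∨ v ∈ᵇ S) (allSubsets n))

-- Fix a maximum critical independent set I. Criticality of I is exactly Hall's condition
-- for matching N(I) into I, and every critical independent set lies in I ∪ N(I). Since an
-- independent subset of I ∪ N(I) injects into I along this matching, every maximum critical
-- independent set contains the unmatched vertices of I and one end of each matched pair;
-- counting gives |diadem| + |nucleus| = 2|I|. If |I| = α, maximum critical independent sets are exactly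
-- maximum independent sets (so diadem = corona), and the matching of N(I) = V ─ I into I
-- has n − α edges (so G is König–Egerváry). If |I| < α, some maximum independent set
-- leaves I ∪ N(I) ⊇ diadem, so diadem ≠ corona. Conversely, in a König–Egerváry graph a
-- maximum matching matches the complement of a maximum independent set S into S, which
-- makes S critical, so |I| = α.

module Submission where

open import Defs
open import Data.Bool using (Bool; true; false; _∧_; _∨_; not; if_then_else_; T; T?) renaming (_≟_ to _≟ᵇ_)
open import Data.Bool.Properties using (¬-not; ∧-zeroʳ; ∧-comm; ∧-assoc; ∨-zeroʳ)
open import Data.Bool.ListAction using (all; any; or)
open import Data.Empty using (⊥; ⊥-elim)
open import Data.Fin as Fin using (Fin; zero; suc)
import Data.Fin.Properties as FinP
open import Data.Fin.Subset using (Subset; ∣_∣)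
open import Data.Fin.Subset.Properties using (anySubset?)
import Data.Integer as ℤ
import Data.Integer.Properties as ℤP
open import Data.Integer.Tactic.RingSolver using () renaming (solve-∀ to ℤ-solve-∀)
open import Data.List using (List; []; _∷_; map; filter; allFin; length; concatMap; mapMaybe)
open import Data.List.Membership.Propositional using (_∈_; find; lose)
open import Data.List.Membership.Propositional.Properties
  using (∈-allFin; ∈-map⁺; ∈-map⁻; ∈-filter⁺; ∈-filter⁻; ∈-++⁺ˡ; ∈-++⁺ʳ; ∈-++⁻
        ; ∈-concatMap⁺; ∈-concatMap⁻)
open import Data.List.Properties using (map-cong; filter-accept)
import Data.List.Membership.Setoid.Properties as SetoidMembership
open import Data.List.Relation.Unary.Any as Any using (here; there)
import Data.List.Relation.Unary.Any.Properties as AnyP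
import Data.List.Relation.Unary.All as All
open import Data.List.Relation.Unary.AllPairs using ([]; _∷_)
open import Data.List.Relation.Unary.Unique.Propositional using (Unique)
import Data.List.Relation.Unary.Unique.Propositional.Properties as UniqueP
open import Data.Maybe using (Maybe; just; nothing)
import Data.Maybe.Relation.Unary.Any as MaybeAny
open import Data.Nat using (ℕ; zero; suc; _+_; _*_; _≤_; _<_; z≤n; s≤s)
open import Data.Nat.Properties
open import Data.Nat.Tactic.RingSolver using (solve-∀)
open import Data.Product using (∃-syntax; _×_; _,_; proj₁; proj₂)
open import Data.Sum using (_⊎_; inj₁; inj₂; [_,_]′)
open import Data.Vec as Vec using (lookup; tabulate)
open import Data.Vec.Properties using (lookup∘tabulate; tabulate-cong)
open import Function.Base using (_∘_; case_of_)
open import Function.Bundles using (_⇔_; mk⇔; module Equivalence)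
open import Relation.Binary.PropositionalEquality
  using (_≡_; _≢_; _≗_; refl; sym; trans; cong; cong₂; subst; subst₂; setoid; module ≡-Reasoning)
open import Relation.Nullary using (¬_; Dec; yes; no)
open import Relation.Nullary.Decidable using (⌊_⌋; toWitness; fromWitness; _×-dec_)

bool-contradiction : ∀ {a} → a ≡ true → a ≡ false → ⊥
bool-contradiction refl ()

∧-trueˡ : ∀ {a b} → a ∧ b ≡ true → a ≡ true
∧-trueˡ {true} _ = refl

∧-trueʳ : ∀ {a b} → a ∧ b ≡ true → b ≡ true
∧-trueʳ {true} e = e

∧-true⁺ : ∀ {a b} → a ≡ true → b ≡ true → a ∧ b ≡ true
∧-true⁺ refl refl = refl

∨-trueˡ : ∀ {a b} → a ≡ true → a ∨ b ≡ true
∨-trueˡ refl = refl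

∨-trueʳ : ∀ {a b} → b ≡ true → a ∨ b ≡ true
∨-trueʳ {a} refl = ∨-zeroʳ a

∨-true⁻ : ∀ {a b} → a ∨ b ≡ true → a ≡ true ⊎ b ≡ true
∨-true⁻ {true}  _ = inj₁ refl
∨-true⁻ {false} e = inj₂ e

∨-false⁻ : ∀ {a b} → a ∨ b ≡ false → a ≡ false × b ≡ false
∨-false⁻ {false} e = refl , e

not-true⁻ : ∀ {a} → not a ≡ true → a ≡ false
not-true⁻ {false} _ = refl

not-true⁺ : ∀ {a} → a ≡ false → not a ≡ true
not-true⁺ refl = refl

≢true⇒false : ∀ {a} → a ≢ true → a ≡ false
≢true⇒false = ¬-not

≢false⇒true : ∀ {a} → a ≢ false → a ≡ true
≢false⇒true = ¬-not

T⇒≡true : ∀ {b} → T b → b ≡ true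
T⇒≡true {true} _ = refl

≡true⇒T : ∀ {b} → b ≡ true → T b
≡true⇒T refl = _

bool-ext : ∀ {a b} → (a ≡ true → b ≡ true) → (b ≡ true → a ≡ true) → a ≡ b
bool-ext {true}  p _ = sym (p refl)
bool-ext {false} {false} _ _ = refl
bool-ext {false} {true}  _ q = q refl

_==_ : ∀ {n} → Fin n → Fin n → Bool
v == w = ⌊ v Fin.≟ w ⌋

==-refl : ∀ {n} (v : Fin n) → v == v ≡ true
==-refl v with v Fin.≟ v
... | yes _ = refl
... | no v≢v = ⊥-elim (v≢v refl)

==⇒≡ : ∀ {n} {v w : Fin n} → v == w ≡ true → v ≡ w
==⇒≡ {v = v} {w} e with v Fin.≟ w
... | yes v≡w = v≡w

≢⇒==false : ∀ {n} {v w : Fin n} → v ≢ w → v == w ≡ false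
≢⇒==false {v = v} {w} v≢w with v Fin.≟ w
... | yes v≡w = ⊥-elim (v≢w v≡w)
... | no _ = refl

-- Vertex sets are handled as characteristic functions; the vectors of Defs are
-- converted by lookup and tabulate.
FSubset : ℕ → Set
FSubset n = Fin n → Bool

module _ {n : ℕ} where

  infixr 7 _∩_
  infixr 6 _∪_ _─_
  infix 4 _⊆_

  _∪_ _∩_ _─_ : FSubset n → FSubset n → FSubset n
  (f ∪ g) i = f i ∨ g i
  (f ∩ g) i = f i ∧ g i
  (f ─ g) i = f i ∧ not (g i)

  ∁ : FSubset n → FSubset n
  ∁ f i = not (f i)

  ∅ : FSubset n
  ∅ _ = false

  ⁅_⁆ : Fin n → FSubset n
  ⁅ w ⁆ v = v == w

  _⊆_ : FSubset n → FSubset n → Set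
  f ⊆ g = ∀ i → f i ≡ true → g i ≡ true

  Disjoint : FSubset n → FSubset n → Set
  Disjoint f g = ∀ i → f i ≡ true → g i ≡ true → ⊥

  ∩-⊆ˡ : ∀ f g → f ∩ g ⊆ f
  ∩-⊆ˡ f g i = ∧-trueˡ

  ∩-⊆ʳ : ∀ f g → f ∩ g ⊆ g
  ∩-⊆ʳ f g i = ∧-trueʳ {f i}

  ─-⊆ : ∀ f g → f ─ g ⊆ f
  ─-⊆ f g i = ∧-trueˡ

  ─-∉ : ∀ f g i → (f ─ g) i ≡ true → g i ≡ false
  ─-∉ f g i e = not-true⁻ (∧-trueʳ {f i} e)

  ─-∈ : ∀ f g {i} → f i ≡ true → g i ≡ false → (f ─ g) i ≡ true
  ─-∈ f g fi gi = ∧-true⁺ fi (not-true⁺ gi)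

  ∩-≗ʳ : ∀ f g → g ⊆ f → f ∩ g ≗ g
  ∩-≗ʳ f g g⊆f i with g i in gi
  ... | true  = cong (_∧ true) (g⊆f i gi)
  ... | false = ∧-zeroʳ (f i)

  ∪-∩-⊆ : ∀ f g h → (f ∪ g) ∩ h ⊆ (f ∩ h) ∪ (g ∩ h)
  ∪-∩-⊆ f g h i e = lemma (f i) (g i) (h i) e
    where
    lemma : ∀ a b c → (a ∨ b) ∧ c ≡ true → (a ∧ c) ∨ (b ∧ c) ≡ true
    lemma true  b     true _ = refl
    lemma false true  true _ = refl

bit : Bool → ℕ
bit true  = 1
bit false = 0

count : ∀ {n} → FSubset n → ℕ
count {zero}  f = 0
count {suc n} f = bit (f zero) + count (f ∘ suc)

∣∣≡count : ∀ {n} (S : Subset n) → ∣ S ∣ ≡ count (lookup S)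
∣∣≡count Vec.[]           = refl
∣∣≡count (true  Vec.∷ S) = cong suc (∣∣≡count S)
∣∣≡count (false Vec.∷ S) = ∣∣≡count S

count-cong : ∀ {n} {f g : FSubset n} → f ≗ g → count f ≡ count g
count-cong {zero}  e = refl
count-cong {suc n} e = cong₂ _+_ (cong bit (e zero)) (count-cong (e ∘ suc))

∣tabulate∣≡count : ∀ {n} (f : FSubset n) → ∣ tabulate f ∣ ≡ count f
∣tabulate∣≡count f = trans (∣∣≡count (tabulate f)) (count-cong (lookup∘tabulate f))

count-∅ : ∀ {n} → count (∅ {n}) ≡ 0
count-∅ {zero}  = refl
count-∅ {suc n} = count-∅ {n}

count-all : ∀ {n} → count {n} (λ _ → true) ≡ n
count-all {zero}  = refl
count-all {suc n} = cong suc (count-all {n})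

count-pointwise : ∀ {n} {f g h k : FSubset n} →
  (∀ i → bit (f i) + bit (g i) ≡ bit (h i) + bit (k i)) →
  count f + count g ≡ count h + count k
count-pointwise {zero}  e = refl
count-pointwise {suc n} {f} {g} {h} {k} e = begin
  (bit (f zero) + count (f ∘ suc)) + (bit (g zero) + count (g ∘ suc))
    ≡⟨ interchange (bit (f zero)) (count (f ∘ suc)) (bit (g zero)) (count (g ∘ suc)) ⟩
  (bit (f zero) + bit (g zero)) + (count (f ∘ suc) + count (g ∘ suc))
    ≡⟨ cong₂ _+_ (e zero) (count-pointwise (e ∘ suc)) ⟩
  (bit (h zero) + bit (k zero)) + (count (h ∘ suc) + count (k ∘ suc))
    ≡⟨ interchange (bit (h zero)) (bit (k zero)) (count (h ∘ suc)) (count (k ∘ suc)) ⟩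
  (bit (h zero) + count (h ∘ suc)) + (bit (k zero) + count (k ∘ suc)) ∎
  where
  open ≡-Reasoning
  interchange : ∀ a b c d → (a + b) + (c + d) ≡ (a + c) + (b + d)
  interchange = solve-∀

count-∪-∩ : ∀ {n} (f g : FSubset n) → count f + count g ≡ count (f ∪ g) + count (f ∩ g)
count-∪-∩ f g = count-pointwise (λ i → lemma (f i) (g i))
  where
  lemma : ∀ a b → bit a + bit b ≡ bit (a ∨ b) + bit (a ∧ b)
  lemma false false = refl
  lemma false true  = refl
  lemma true  false = refl
  lemma true  true  = refl

count-split : ∀ {n} (f g : FSubset n) → count f ≡ count (f ∩ g) + count (f ─ g)
count-split {n} f g = trans (sym (+-identityʳ (count f)))
  (trans (cong (count f +_) (sym (count-∅ {n}))) (count-pointwise (λ i → lemma (f i) (g i))))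
  where
  lemma : ∀ a b → bit a + 0 ≡ bit (a ∧ b) + bit (a ∧ not b)
  lemma false b     = refl
  lemma true  false = refl
  lemma true  true  = refl

count-∁ : ∀ {n} (f : FSubset n) → count f + count (∁ f) ≡ n
count-∁ {n} f = begin
  count f + count (∁ f)
    ≡⟨ count-pointwise {f = f} {g = ∁ f} {h = λ _ → true} {k = ∅ {n}} (λ i → lemma (f i)) ⟩
  count {n} (λ _ → true) + count (∅ {n}) ≡⟨ cong₂ _+_ (count-all {n}) (count-∅ {n}) ⟩
  n + 0                               ≡⟨ +-identityʳ n ⟩
  n                                   ∎
  where
  open ≡-Reasoning
  lemma : ∀ a → bit a + bit (not a) ≡ 1 + 0
  lemma false = refl
  lemma true  = refl

bit-mono : ∀ {a b} → (a ≡ true → b ≡ true) → bit a ≤ bit b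
bit-mono {false} _ = z≤n
bit-mono {true}  h rewrite h refl = ≤-refl

count-mono : ∀ {n} {f g : FSubset n} → f ⊆ g → count f ≤ count g
count-mono {zero}  f⊆g = z≤n
count-mono {suc n} f⊆g = +-mono-≤ (bit-mono (f⊆g zero)) (count-mono (f⊆g ∘ suc))

count-mono-< : ∀ {n} {f g : FSubset n} → f ⊆ g → ∀ w → g w ≡ true → f w ≡ false → count f < count g
count-mono-< {suc n} f⊆g zero gw fw rewrite gw | fw = s≤s (count-mono (f⊆g ∘ suc))
count-mono-< {suc n} {f} {g} f⊆g (suc w) gw fw =
  subst (_≤ count g) (+-suc (bit (f zero)) (count (f ∘ suc)))
    (+-mono-≤ (bit-mono (f⊆g zero)) (count-mono-< (f⊆g ∘ suc) w gw fw))

count≤n : ∀ {n} (f : FSubset n) → count f ≤ n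
count≤n {n} f = subst (count f ≤_) (count-all {n}) (count-mono {f = f} {g = λ _ → true} (λ _ _ → refl))

count≡0⇒∅ : ∀ {n} (f : FSubset n) → count f ≡ 0 → ∀ i → f i ≡ false
count≡0⇒∅ {suc n} f e zero with f zero
... | false = refl
count≡0⇒∅ {suc n} f e (suc i) with f zero
... | false = count≡0⇒∅ (f ∘ suc) e i

count>0⇒∃ : ∀ {n} (f : FSubset n) → 0 < count f → ∃[ i ] f i ≡ true
count>0⇒∃ {suc n} f p with f zero in eq
... | true  = zero , eq
... | false with count>0⇒∃ (f ∘ suc) p
...   | i , fi = suc i , fi

count-∪-≤ : ∀ {n} (f g : FSubset n) → count (f ∪ g) ≤ count f + count g
count-∪-≤ f g = subst (count (f ∪ g) ≤_) (sym (count-∪-∩ f g)) (m≤m+n _ _)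

count-disjoint-∪ : ∀ {n} {f g : FSubset n} → Disjoint f g → count (f ∪ g) ≡ count f + count g
count-disjoint-∪ {n} {f} {g} f#g = sym (begin
  count f + count g                 ≡⟨ count-∪-∩ f g ⟩
  count (f ∪ g) + count (f ∩ g)     ≡⟨ cong (count (f ∪ g) +_) (trans (count-cong f∩g≗∅) (count-∅ {n})) ⟩
  count (f ∪ g) + 0                 ≡⟨ +-identityʳ _ ⟩
  count (f ∪ g)                     ∎)
  where
  open ≡-Reasoning
  f∩g≗∅ : f ∩ g ≗ ∅
  f∩g≗∅ i = ≢true⇒false (λ e → f#g i (∧-trueˡ e) (∧-trueʳ {f i} e))

count-disjoint-≤ : ∀ {n} {f g h : FSubset n} → Disjoint f g → f ⊆ h → g ⊆ h → count f + count g ≤ count h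
count-disjoint-≤ {f = f} {g} f#g f⊆h g⊆h = subst (_≤ _) (count-disjoint-∪ f#g)
  (count-mono (λ i e → [ f⊆h i , g⊆h i ]′ (∨-true⁻ {f i} e)))

count-⁅⁆ : ∀ {n} (w : Fin n) → count ⁅ w ⁆ ≡ 1
count-⁅⁆ {suc n} zero =
  cong suc (trans (count-cong {n} {g = ∅} (λ i → ≢⇒==false {v = suc i} {zero} λ ())) (count-∅ {n}))
count-⁅⁆ {suc n} (suc w) = trans (count-cong {f = ⁅ suc w ⁆ ∘ suc} {⁅ w ⁆} shift) (count-⁅⁆ w)
  where
  shift : ∀ i → suc i == suc w ≡ i == w
  shift i = by-cases (i Fin.≟ w)
    where
    by-cases : Dec (i ≡ w) → suc i == suc w ≡ i == w
    by-cases (yes refl) = trans (==-refl (suc i)) (sym (==-refl i))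
    by-cases (no i≢w)   = trans (≢⇒==false (i≢w ∘ FinP.suc-injective)) (sym (≢⇒==false i≢w))

─⁅⁆-∈ : ∀ {n} (B : FSubset n) {v w} → B v ≡ true → v ≢ w → (B ─ ⁅ w ⁆) v ≡ true
─⁅⁆-∈ B {w = w} Bv v≢w = ─-∈ B ⁅ w ⁆ Bv (≢⇒==false v≢w)

count-─⁅⁆ : ∀ {n} (B : FSubset n) w → B w ≡ true → count (B ─ ⁅ w ⁆) < count B
count-─⁅⁆ B w Bw = count-mono-< (─-⊆ B ⁅ w ⁆) w Bw (trans (cong (λ b → B w ∧ not b) (==-refl w)) (∧-zeroʳ (B w)))

count≤suc-─⁅⁆ : ∀ {n} (B : FSubset n) w → count B ≤ suc (count (B ─ ⁅ w ⁆))
count≤suc-─⁅⁆ B w = subst (_≤ suc (count (B ─ ⁅ w ⁆))) (sym (count-split B ⁅ w ⁆))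
  (+-monoˡ-≤ (count (B ─ ⁅ w ⁆)) (subst (count (B ∩ ⁅ w ⁆) ≤_) (count-⁅⁆ w) (count-mono (∩-⊆ʳ B ⁅ w ⁆))))

count-≤-injectionᵈ : ∀ {m k} (A : FSubset m) (B : FSubset k) (h : ∀ i → A i ≡ true → Fin k) →
  (∀ i a → B (h i a) ≡ true) → (∀ i j a b → h i a ≡ h j b → i ≡ j) → count A ≤ count B
count-≤-injectionᵈ {zero}  A B h maps inj = z≤n
count-≤-injectionᵈ {suc m} {k} A B h maps inj with A zero in A0
... | false = count-≤-injectionᵈ (A ∘ suc) B (h ∘ suc) (maps ∘ suc)
                (λ i j a b e → FinP.suc-injective (inj (suc i) (suc j) a b e))
... | true  = ≤-trans (s≤s (count-≤-injectionᵈ (A ∘ suc) (B ─ ⁅ h₀ ⁆) (h ∘ suc) maps′ inj′))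
                      (count-─⁅⁆ B h₀ (maps zero A0))
  where
  h₀ : Fin k
  h₀ = h zero A0
  maps′ : ∀ i a → (B ─ ⁅ h₀ ⁆) (h (suc i) a) ≡ true
  maps′ i a = ─⁅⁆-∈ B (maps (suc i) a) (λ e → case inj (suc i) zero a A0 e of λ ())
  inj′ : ∀ i j a b → h (suc i) a ≡ h (suc j) b → i ≡ j
  inj′ i j a b e = FinP.suc-injective (inj (suc i) (suc j) a b e)

count-≤-injection : ∀ {m k} (A : FSubset m) (B : FSubset k) (h : Fin m → Fin k) →
  (∀ i → A i ≡ true → B (h i) ≡ true) →
  (∀ i j → A i ≡ true → A j ≡ true → h i ≡ h j → i ≡ j) → count A ≤ count B
count-≤-injection A B h maps inj = count-≤-injectionᵈ A B (λ i _ → h i) maps inj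

count-<-injection : ∀ {m k} (A : FSubset m) (B : FSubset k) (h : Fin m → Fin k) →
  (∀ i → A i ≡ true → B (h i) ≡ true) →
  (∀ i j → A i ≡ true → A j ≡ true → h i ≡ h j → i ≡ j) →
  ∀ w → B w ≡ true → (∀ i → A i ≡ true → h i ≢ w) → count A < count B
count-<-injection A B h maps inj w Bw missed = ≤-trans
  (s≤s (count-≤-injection A (B ─ ⁅ w ⁆) h (λ i a → ─⁅⁆-∈ B (maps i a) (missed i a)) inj))
  (count-─⁅⁆ B w Bw)

module _ {A : Set} (p : A → Bool) where

  all-≡true⁻ : ∀ xs → all p xs ≡ true → ∀ {x} → x ∈ xs → p x ≡ true
  all-≡true⁻ (y ∷ ys) e (here refl) = ∧-trueˡ e
  all-≡true⁻ (y ∷ ys) e (there x∈) = all-≡true⁻ ys (∧-trueʳ {p y} e) x∈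

  all-≡true⁺ : ∀ xs → (∀ {x} → x ∈ xs → p x ≡ true) → all p xs ≡ true
  all-≡true⁺ []       h = refl
  all-≡true⁺ (y ∷ ys) h = ∧-true⁺ (h (here refl)) (all-≡true⁺ ys (h ∘ there))

  all-≡false⁻ : ∀ xs → all p xs ≡ false → ∃[ x ] (x ∈ xs × p x ≡ false)
  all-≡false⁻ (y ∷ ys) e with p y in py
  ... | false = y , here refl , py
  ... | true with all-≡false⁻ ys e
  ...   | x , x∈ , px = x , there x∈ , px

  any-≡true⁻ : ∀ xs → any p xs ≡ true → ∃[ x ] (x ∈ xs × p x ≡ true)
  any-≡true⁻ (y ∷ ys) e with p y in py
  ... | true  = y , here refl , py
  ... | false with any-≡true⁻ ys e
  ...   | x , x∈ , px = x , there x∈ , px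

  any-≡true⁺ : ∀ xs {x} → x ∈ xs → p x ≡ true → any p xs ≡ true
  any-≡true⁺ (y ∷ ys) (here refl) px rewrite px = refl
  any-≡true⁺ (y ∷ ys) (there x∈) px rewrite any-≡true⁺ ys x∈ px = ∨-zeroʳ (p y)

any-cong : ∀ {A : Set} {p q : A → Bool} → p ≗ q → ∀ xs → any p xs ≡ any q xs
any-cong p≗q xs = cong or (map-cong p≗q xs)

∈-allSubsets : ∀ {n} (S : Subset n) → S ∈ allSubsets n
∈-allSubsets Vec.[] = here refl
∈-allSubsets (false Vec.∷ S) = ∈-++⁺ˡ (∈-map⁺ (false Vec.∷_) (∈-allSubsets S))
∈-allSubsets {suc n} (true Vec.∷ S) =
  ∈-++⁺ʳ (map (false Vec.∷_) (allSubsets n)) (∈-map⁺ (true Vec.∷_) (∈-allSubsets S))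

maxℕ-upper : ∀ {x} xs → x ∈ xs → x ≤ maxℕ xs
maxℕ-upper (y ∷ ys) (here refl) = m≤m⊔n y (maxℕ ys)
maxℕ-upper (y ∷ ys) (there x∈)  = ≤-trans (maxℕ-upper ys x∈) (m≤n⊔m y (maxℕ ys))

maxℕ-least : ∀ xs b → (∀ {x} → x ∈ xs → x ≤ b) → maxℕ xs ≤ b
maxℕ-least []       b h = z≤n
maxℕ-least (y ∷ ys) b h = ⊔-lub (h (here refl)) (maxℕ-least ys b (h ∘ there))

maxℕ-≡0⊎∈ : ∀ xs → maxℕ xs ≡ 0 ⊎ maxℕ xs ∈ xs
maxℕ-≡0⊎∈ []       = inj₁ refl
maxℕ-≡0⊎∈ (y ∷ ys) with ⊔-sel y (maxℕ ys)
... | inj₁ e = inj₂ (subst (_∈ y ∷ ys) (sym e) (here refl))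
... | inj₂ e with maxℕ-≡0⊎∈ ys
...   | inj₁ z  = inj₁ (trans e z)
...   | inj₂ m∈ = inj₂ (subst (_∈ y ∷ ys) (sym e) (there m∈))

maxℕ-∈ : ∀ {x} xs → x ∈ xs → maxℕ xs ∈ xs
maxℕ-∈ {x} xs x∈ with maxℕ-≡0⊎∈ xs
... | inj₂ m∈ = m∈
... | inj₁ z  = subst (_∈ xs) (trans (n≤0⇒n≡0 (subst (x ≤_) z (maxℕ-upper xs x∈))) (sym z)) x∈

maxℤ-upper : ∀ {x} xs → x ∈ xs → x ℤ.≤ maxℤ xs
maxℤ-upper (y ∷ ys) (here refl) = ℤP.i≤i⊔j y (maxℤ ys)
maxℤ-upper (y ∷ ys) (there x∈)  = ℤP.≤-trans (maxℤ-upper ys x∈) (ℤP.i≤j⊔i y (maxℤ ys))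

maxℤ-≡0⊎∈ : ∀ xs → maxℤ xs ≡ ℤ.+ 0 ⊎ maxℤ xs ∈ xs
maxℤ-≡0⊎∈ []       = inj₁ refl
maxℤ-≡0⊎∈ (y ∷ ys) with ℤP.⊔-sel y (maxℤ ys)
... | inj₁ e = inj₂ (subst (_∈ y ∷ ys) (sym e) (here refl))
... | inj₂ e with maxℤ-≡0⊎∈ ys
...   | inj₁ z  = inj₁ (trans e z)
...   | inj₂ m∈ = inj₂ (subst (_∈ y ∷ ys) (sym e) (there m∈))

maxSize : ∀ {n} → (Subset n → Bool) → ℕ
maxSize {n} P = maxℕ (map ∣_∣ (filter (T? ∘ P) (allSubsets n)))

module _ {n : ℕ} (P : Subset n → Bool) where

  private
    size∈ : ∀ S → P S ≡ true → ∣ S ∣ ∈ map ∣_∣ (filter (T? ∘ P) (allSubsets n))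
    size∈ S PS = ∈-map⁺ ∣_∣ (∈-filter⁺ (T? ∘ P) (∈-allSubsets S) (≡true⇒T PS))

  maxSize-upper : ∀ S → P S ≡ true → ∣ S ∣ ≤ maxSize P
  maxSize-upper S PS = maxℕ-upper _ (size∈ S PS)

  maxSize-attained : ∀ S → P S ≡ true → ∃[ S′ ] (P S′ ≡ true × ∣ S′ ∣ ≡ maxSize P)
  maxSize-attained S PS with ∈-map⁻ ∣_∣ (maxℕ-∈ _ (size∈ S PS))
  ... | S′ , S′∈ , e = S′ , T⇒≡true (proj₂ (∈-filter⁻ (T? ∘ P) {xs = allSubsets n} S′∈)) , sym e

≤-by-sum : ∀ {x y r a₁ b₁ a₂ b₂} → a₁ ≤ b₁ → a₂ ≤ b₂ →
  a₁ + a₂ ≡ x + r → b₁ + b₂ ≡ y + r → x ≤ y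
≤-by-sum {x} {y} {r} a₁≤b₁ a₂≤b₂ eqa eqb =
  +-cancelʳ-≤ r x y (subst₂ _≤_ eqa eqb (+-mono-≤ a₁≤b₁ a₂≤b₂))

diff-≤-diff : ∀ a b c e → (ℤ.+ a ℤ.- ℤ.+ b ℤ.≤ ℤ.+ c ℤ.- ℤ.+ e) ⇔ (a + e ≤ c + b)
diff-≤-diff a b c e = mk⇔ to from
  where
  k : ℤ.ℤ
  k = ℤ.+ b ℤ.+ ℤ.+ e
  shift : ∀ x y z → (x ℤ.- y) ℤ.+ (y ℤ.+ z) ≡ x ℤ.+ z
  shift = ℤ-solve-∀
  unshift : ∀ x y → (x ℤ.+ y) ℤ.- y ≡ x
  unshift = ℤ-solve-∀
  lhs : (ℤ.+ a ℤ.- ℤ.+ b) ℤ.+ k ≡ ℤ.+ (a + e)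
  lhs = trans (shift (ℤ.+ a) (ℤ.+ b) (ℤ.+ e)) (sym (ℤP.pos-+ a e))
  rhs : (ℤ.+ c ℤ.- ℤ.+ e) ℤ.+ k ≡ ℤ.+ (c + b)
  rhs = trans (cong (ℤ._+_ (ℤ.+ c ℤ.- ℤ.+ e)) (ℤP.+-comm (ℤ.+ b) (ℤ.+ e)))
              (trans (shift (ℤ.+ c) (ℤ.+ e) (ℤ.+ b)) (sym (ℤP.pos-+ c b)))
  to : ℤ.+ a ℤ.- ℤ.+ b ℤ.≤ ℤ.+ c ℤ.- ℤ.+ e → a + e ≤ c + b
  to h = ℤP.drop‿+≤+ (subst₂ ℤ._≤_ lhs rhs (ℤP.+-monoˡ-≤ k h))
  from : a + e ≤ c + b → ℤ.+ a ℤ.- ℤ.+ b ℤ.≤ ℤ.+ c ℤ.- ℤ.+ e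
  from h = subst₂ ℤ._≤_ (unshift _ k) (unshift _ k)
    (ℤP.+-monoˡ-≤ (ℤ.- k) (subst₂ ℤ._≤_ (sym lhs) (sym rhs) (ℤ.+≤+ h)))

-- Neighbourhoods, independence and criticality

module Independence {n : ℕ} (G : Graph n) where

  Nbr : FSubset n → FSubset n
  Nbr X v = any (λ u → X u ∧ adj G u v) (allFin n)

  ∣N∣≡count : ∀ S → ∣ N G S ∣ ≡ count (Nbr (lookup S))
  ∣N∣≡count S = trans (∣∣≡count (N G S)) (count-cong (lookup∘tabulate (Nbr (lookup S))))

  Nbr⁺ : ∀ {X u v} → X u ≡ true → adj G u v ≡ true → Nbr X v ≡ true
  Nbr⁺ {X} {u} {v} Xu uv = any-≡true⁺ (λ u → X u ∧ adj G u v) (allFin n) (∈-allFin u) (∧-true⁺ Xu uv)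

  Nbr⁻ : ∀ {X v} → Nbr X v ≡ true → ∃[ u ] (X u ≡ true × adj G u v ≡ true)
  Nbr⁻ {X} {v} e with any-≡true⁻ (λ u → X u ∧ adj G u v) (allFin n) e
  ... | u , _ , Xu∧uv = u , ∧-trueˡ Xu∧uv , ∧-trueʳ {X u} Xu∧uv

  Nbr-cong : ∀ {X Y} → X ≗ Y → Nbr X ≗ Nbr Y
  Nbr-cong X≗Y v = any-cong (λ u → cong (_∧ adj G u v) (X≗Y u)) (allFin n)

  Nbr-mono : ∀ {X Y} → X ⊆ Y → Nbr X ⊆ Nbr Y
  Nbr-mono X⊆Y v e with Nbr⁻ e
  ... | u , Xu , uv = Nbr⁺ (X⊆Y u Xu) uv

  Nbr-∪ : ∀ X Y → Nbr (X ∪ Y) ≗ Nbr X ∪ Nbr Y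
  Nbr-∪ X Y v = bool-ext to from
    where
    to : Nbr (X ∪ Y) v ≡ true → (Nbr X ∪ Nbr Y) v ≡ true
    to e with Nbr⁻ e
    ... | u , XYu , uv =
      [ (λ Xu → ∨-trueˡ (Nbr⁺ Xu uv)) , (λ Yu → ∨-trueʳ {Nbr X v} (Nbr⁺ Yu uv)) ]′ (∨-true⁻ {X u} XYu)
    from : (Nbr X ∪ Nbr Y) v ≡ true → Nbr (X ∪ Y) v ≡ true
    from e = [ Nbr-mono (λ _ → ∨-trueˡ) v , Nbr-mono (λ i → ∨-trueʳ {X i}) v ]′ (∨-true⁻ {Nbr X v} e)

  Nbr-∅ : Nbr ∅ ≗ ∅
  Nbr-∅ v = ≢true⇒false (λ e → case Nbr⁻ {∅} {v} e of λ { (_ , () , _) })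

  Independent : FSubset n → Set
  Independent X = ∀ u v → X u ≡ true → X v ≡ true → adj G u v ≡ false

  independent⁻ : ∀ S → independent G S ≡ true → Independent (lookup S)
  independent⁻ S e u v Su Sv = lemma (lookup S u) (lookup S v) (adj G u v)
    (all-≡true⁻ _ (allFin n) (all-≡true⁻ _ (allFin n) e (∈-allFin u)) (∈-allFin v)) Su Sv
    where
    lemma : ∀ a b c → not (a ∧ b ∧ c) ≡ true → a ≡ true → b ≡ true → c ≡ false
    lemma true true false _ _ _ = refl

  independent⁺ : ∀ S → Independent (lookup S) → independent G S ≡ true
  independent⁺ S h = all-≡true⁺ _ (allFin n) λ {u} _ → all-≡true⁺ _ (allFin n) λ {v} _ →
    lemma (lookup S u) (lookup S v) (adj G u v) (h u v)
    where
    lemma : ∀ a b c → (a ≡ true → b ≡ true → c ≡ false) → not (a ∧ b ∧ c) ≡ true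
    lemma false b c _ = refl
    lemma true false c _ = refl
    lemma true true c h rewrite h refl refl = refl

  independent-cong : ∀ {X Y} → X ≗ Y → Independent X → Independent Y
  independent-cong X≗Y X-ind u v Yu Yv = X-ind u v (trans (X≗Y u) Yu) (trans (X≗Y v) Yv)

  independent-tabulate : ∀ X → Independent X → independent G (tabulate X) ≡ true
  independent-tabulate X = independent⁺ (tabulate X) ∘ independent-cong (sym ∘ lookup∘tabulate X)

  independent⇒∉Nbr : ∀ {X} → Independent X → ∀ v → X v ≡ true → Nbr X v ≡ false
  independent⇒∉Nbr {X} X-ind v Xv = ≢true⇒false λ e →
    let u , Xu , uv = Nbr⁻ e in bool-contradiction uv (X-ind u v Xu Xv)

  -- d(Y) ≤ d(X), with both sides moved so that no subtraction occurs.
  Critical : FSubset n → Set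
  Critical X = ∀ Y → count Y + count (Nbr X) ≤ count X + count (Nbr Y)

  CriticalIndependent : FSubset n → Set
  CriticalIndependent X = Independent X × Critical X

  d≤dmax : ∀ S → d G S ℤ.≤ dmax G
  d≤dmax S = maxℤ-upper (map (d G) (allSubsets n)) (∈-map⁺ (d G) (∈-allSubsets S))

  -- The fold defining dmax starts at 0; this value is attained too, by the empty set.
  dmax-attained : ∃[ S ] dmax G ≡ d G S
  dmax-attained with maxℤ-≡0⊎∈ (map (d G) (allSubsets n))
  ... | inj₂ dmax∈ = let S , _ , e = ∈-map⁻ (d G) dmax∈ in S , e
  ... | inj₁ dmax≡0 = tabulate ∅ , trans dmax≡0 (sym d∅≡0)
    where
    d∅≡0 : d G (tabulate ∅) ≡ ℤ.+ 0
    d∅≡0 rewrite ∣tabulate∣≡count (∅ {n}) | count-∅ {n} | ∣N∣≡count (tabulate ∅)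
               | count-cong (λ v → trans (Nbr-cong (lookup∘tabulate ∅) v) (Nbr-∅ v)) | count-∅ {n} = refl

  private
    count-Nbr-tabulate : ∀ Y → ∣ N G (tabulate Y) ∣ ≡ count (Nbr Y)
    count-Nbr-tabulate Y = trans (∣N∣≡count (tabulate Y)) (count-cong (Nbr-cong (lookup∘tabulate Y)))

  critical⁻ : ∀ S → d G S ≡ dmax G → Critical (lookup S)
  critical⁻ S dS≡dmax Y = subst₂ _≤_
    (cong₂ _+_ (∣tabulate∣≡count Y) (∣N∣≡count S)) (cong₂ _+_ (∣∣≡count S) (count-Nbr-tabulate Y))
    (Equivalence.to (diff-≤-diff (∣ tabulate Y ∣) (∣ N G (tabulate Y) ∣) (∣ S ∣) (∣ N G S ∣))
      (subst (d G (tabulate Y) ℤ.≤_) (sym dS≡dmax) (d≤dmax (tabulate Y))))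

  critical⁺ : ∀ S → Critical (lookup S) → d G S ≡ dmax G
  critical⁺ S S-crit with dmax-attained
  ... | S₀ , dmax≡dS₀ = ℤP.≤-antisym (d≤dmax S) (subst (ℤ._≤ d G S) (sym dmax≡dS₀)
    (Equivalence.from (diff-≤-diff (∣ S₀ ∣) (∣ N G S₀ ∣) (∣ S ∣) (∣ N G S ∣)) (subst₂ _≤_
      (sym (cong₂ _+_ (∣∣≡count S₀) (∣N∣≡count S))) (sym (cong₂ _+_ (∣∣≡count S) (∣N∣≡count S₀)))
      (S-crit (lookup S₀)))))

  critical-cong : ∀ {X Y} → X ≗ Y → Critical X → Critical Y
  critical-cong X≗Y X-crit Z = subst₂ _≤_
    (cong (count Z +_) (count-cong (Nbr-cong X≗Y))) (cong (_+ count (Nbr Z)) (count-cong X≗Y)) (X-crit Z)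

  criticalIndependent⁻ : ∀ S → criticalIndependent G S ≡ true → CriticalIndependent (lookup S)
  criticalIndependent⁻ S e =
    independent⁻ S (∧-trueˡ e) , critical⁻ S (toWitness (≡true⇒T (∧-trueʳ {independent G S} e)))

  criticalIndependent⁺ : ∀ S → CriticalIndependent (lookup S) → criticalIndependent G S ≡ true
  criticalIndependent⁺ S (S-ind , S-crit) =
    ∧-true⁺ (independent⁺ S S-ind) (T⇒≡true (fromWitness (critical⁺ S S-crit)))

  criticalIndependent-tabulate : ∀ X → CriticalIndependent X → criticalIndependent G (tabulate X) ≡ true
  criticalIndependent-tabulate X (X-ind , X-crit) = criticalIndependent⁺ (tabulate X)
    (independent-cong X≗ X-ind , critical-cong X≗ X-crit)
    where
    X≗ : X ≗ lookup (tabulate X)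
    X≗ = sym ∘ lookup∘tabulate X

-- Critical sets

module CriticalSets {n : ℕ} (G : Graph n) where

  open Independence G

  ─Nbr-independent : ∀ Y → Independent (Y ─ Nbr Y)
  ─Nbr-independent Y u v Ru Rv = ≢true⇒false λ uv →
    bool-contradiction (Nbr⁺ (∧-trueˡ Ru) uv) (─-∉ Y (Nbr Y) v Rv)

  d≤d-─Nbr : ∀ Y → count Y + count (Nbr (Y ─ Nbr Y)) ≤ count (Y ─ Nbr Y) + count (Nbr Y)
  d≤d-─Nbr Y = begin
    count Y + count (Nbr R)                        ≡⟨ cong (_+ count (Nbr R)) (count-split Y (Nbr Y)) ⟩
    (count (Y ∩ Nbr Y) + count R) + count (Nbr R)  ≡⟨ swap (count (Y ∩ Nbr Y)) (count R) (count (Nbr R)) ⟩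
    count R + (count (Y ∩ Nbr Y) + count (Nbr R))  ≤⟨ +-monoʳ-≤ (count R) bound ⟩
    count R + count (Nbr Y)                        ∎
    where
    open ≤-Reasoning
    R : FSubset n
    R = Y ─ Nbr Y
    swap : ∀ a b c → (a + b) + c ≡ b + (a + c)
    swap = solve-∀
    disjoint : Disjoint (Y ∩ Nbr Y) (Nbr R)
    disjoint v YNv NRv = let u , Ru , uv = Nbr⁻ NRv in
      bool-contradiction (Nbr⁺ (∧-trueˡ YNv) (trans (adj-sym G v u) uv)) (─-∉ Y (Nbr Y) u Ru)
    bound : count (Y ∩ Nbr Y) + count (Nbr R) ≤ count (Nbr Y)
    bound = count-disjoint-≤ disjoint (∩-⊆ʳ Y (Nbr Y)) (Nbr-mono (─-⊆ Y (Nbr Y)))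

  critical-─Nbr : ∀ Y → Critical Y → Critical (Y ─ Nbr Y)
  critical-─Nbr Y Y-crit Z = ≤-by-sum (Y-crit Z) (d≤d-─Nbr Y)
    (lhs (count Z) (count (Nbr Y)) (count Y) (count (Nbr R)))
    (rhs (count Y) (count (Nbr Z)) (count R) (count (Nbr Y)))
    where
    R : FSubset n
    R = Y ─ Nbr Y
    lhs : ∀ z ny y nr → z + ny + (y + nr) ≡ (z + nr) + (ny + y)
    lhs = solve-∀
    rhs : ∀ y nz r ny → y + nz + (r + ny) ≡ (r + nz) + (ny + y)
    rhs = solve-∀

  critical-∪ : ∀ I I′ → Critical I → Critical I′ → Critical (I ∪ I′)
  critical-∪ I I′ I-crit I′-crit Z = ≤-by-sum
    (+-mono-≤ (+-mono-≤ (I-crit Z) (I′-crit (I ∩ I′))) Nbr-bound) (≤-reflexive (count-∪-∩ I I′))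
    (lhs (count Z) (count (Nbr I)) (count (I ∩ I′)) (count (Nbr I′))
         (count (Nbr (I ∪ I′))) (count (Nbr (I ∩ I′))) (count I) (count I′))
    (rhs (count I) (count (Nbr Z)) (count I′) (count (Nbr (I ∩ I′)))
         (count (Nbr I)) (count (Nbr I′)) (count (I ∪ I′)) (count (I ∩ I′)))
    where
    Nbr-bound : count (Nbr (I ∪ I′)) + count (Nbr (I ∩ I′)) ≤ count (Nbr I) + count (Nbr I′)
    Nbr-bound = subst (count (Nbr (I ∪ I′)) + count (Nbr (I ∩ I′)) ≤_) (sym (count-∪-∩ (Nbr I) (Nbr I′))) (+-mono-≤
      (≤-reflexive (count-cong (Nbr-∪ I I′)))
      (count-mono λ v e → ∧-true⁺ (Nbr-mono (∩-⊆ˡ I I′) v e) (Nbr-mono (∩-⊆ʳ I I′) v e)))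
    lhs : ∀ z ni ii ni′ nu nii i i′ →
      z + ni + (ii + ni′) + (nu + nii) + (i + i′) ≡ (z + nu) + (ni + ii + ni′ + nii + i + i′)
    lhs = solve-∀
    rhs : ∀ i nz i′ nii ni ni′ u ii →
      i + nz + (i′ + nii) + (ni + ni′) + (u + ii) ≡ (u + nz) + (ni + ii + ni′ + nii + i + i′)
    rhs = solve-∀

  -- With J the part of I′ outside I ∪ N(I), the set I ∪ J is again critical independent,
  -- so J is empty when I is a largest critical independent set.
  module Extension (I I′ : FSubset n) (I-ci : CriticalIndependent I) (I′-ci : CriticalIndependent I′) where

    J U K A : FSubset n
    J = I′ ─ (I ∪ Nbr I)
    U = I ∪ I′
    K = U ─ Nbr U
    A = I ─ Nbr I′

    J-∉ : ∀ v → J v ≡ true → I v ≡ false × Nbr I v ≡ false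
    J-∉ v Jv = ∨-false⁻ (─-∉ I′ (I ∪ Nbr I) v Jv)

    K-∉Nbr : ∀ v → K v ≡ true → Nbr I v ≡ false × Nbr I′ v ≡ false
    K-∉Nbr v Kv = ∨-false⁻ (trans (sym (Nbr-∪ I I′ v)) (─-∉ U (Nbr U) v Kv))

    K⁺ : ∀ {v} → U v ≡ true → Nbr I v ≡ false → Nbr I′ v ≡ false → K v ≡ true
    K⁺ {v} Uv NIv NI′v = ─-∈ U (Nbr U) Uv (trans (Nbr-∪ I I′ v) (cong₂ _∨_ NIv NI′v))

    K⊆A∪J : K ⊆ A ∪ J
    K⊆A∪J v Kv = by-cases (I v) refl
      where
      by-cases : ∀ b → I v ≡ b → (A ∪ J) v ≡ true
      by-cases true  Iv = ∨-trueˡ (─-∈ I (Nbr I′) Iv (proj₂ (K-∉Nbr v Kv)))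
      by-cases false Iv = ∨-trueʳ {A v} (─-∈ I′ (I ∪ Nbr I) (I′v Iv) (cong₂ _∨_ Iv (proj₁ (K-∉Nbr v Kv))))
        where
        I′v : I v ≡ false → I′ v ≡ true
        I′v Iv = [ (λ e → ⊥-elim (bool-contradiction e Iv)) , (λ e → e) ]′ (∨-true⁻ {I v} (─-⊆ U (Nbr U) v Kv))

    A⊆K : A ⊆ K
    A⊆K v Av = let Iv = ─-⊆ I (Nbr I′) v Av in
      K⁺ (∨-trueˡ Iv) (independent⇒∉Nbr (proj₁ I-ci) v Iv) (─-∉ I (Nbr I′) v Av)

    J⊆K : J ⊆ K
    J⊆K v Jv = let I′v = ─-⊆ I′ (I ∪ Nbr I) v Jv in
      K⁺ (∨-trueʳ {I v} I′v) (proj₂ (J-∉ v Jv)) (independent⇒∉Nbr (proj₁ I′-ci) v I′v)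

    count-I∪J : count (I ∪ J) ≡ count I + count J
    count-I∪J = count-disjoint-∪ λ v Iv Jv → bool-contradiction Iv (proj₁ (J-∉ v Jv))

    count-Nbr-I∪J : count (Nbr (I ∪ J)) ≡ count (Nbr I) + count (Nbr J ─ Nbr I)
    count-Nbr-I∪J = trans (count-cong λ v → trans (Nbr-∪ I J v) (absorb (Nbr I v) (Nbr J v)))
      (count-disjoint-∪ λ v NIv NJv → bool-contradiction NIv (─-∉ (Nbr J) (Nbr I) v NJv))
      where
      absorb : ∀ a b → a ∨ b ≡ a ∨ (b ∧ not a)
      absorb true  b     = refl
      absorb false true  = refl
      absorb false false = refl

    I∪J-independent : Independent (I ∪ J)
    I∪J-independent u w IJu IJw with ∨-true⁻ {I u} IJu | ∨-true⁻ {I w} IJw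
    ... | inj₁ Iu | inj₁ Iw = proj₁ I-ci u w Iu Iw
    ... | inj₂ Ju | inj₂ Jw = proj₁ I′-ci u w (─-⊆ I′ (I ∪ Nbr I) u Ju) (─-⊆ I′ (I ∪ Nbr I) w Jw)
    ... | inj₁ Iu | inj₂ Jw = ≢true⇒false λ uw → bool-contradiction (Nbr⁺ Iu uw) (proj₂ (J-∉ w Jw))
    ... | inj₂ Ju | inj₁ Iw = ≢true⇒false λ uw →
      bool-contradiction (Nbr⁺ Iw (trans (adj-sym G w u) uw)) (proj₂ (J-∉ u Ju))

    I∪J-critical : Critical (I ∪ J)
    I∪J-critical Z = subst₂ _≤_
      (cong (count Z +_) (sym count-Nbr-I∪J)) (cong (_+ count (Nbr Z)) (sym count-I∪J))
      (≤-by-sum (+-mono-≤ (+-mono-≤ (K-critical Z) (proj₂ I-ci A)) Nbr-bound) K-bound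
        (lhs (count Z) (count (Nbr K)) (count A) (count (Nbr I)) (count (Nbr A)) (count (Nbr J ─ Nbr I)) (count K))
        (rhs (count K) (count (Nbr Z)) (count I) (count (Nbr A)) (count (Nbr K)) (count A) (count J)))
      where
      K-critical : Critical K
      K-critical = critical-─Nbr U (critical-∪ I I′ (proj₂ I-ci) (proj₂ I′-ci))
      Nbr-bound : count (Nbr A) + count (Nbr J ─ Nbr I) ≤ count (Nbr K)
      Nbr-bound = count-disjoint-≤
        (λ v NAv NJv → bool-contradiction (Nbr-mono (─-⊆ I (Nbr I′)) v NAv) (─-∉ (Nbr J) (Nbr I) v NJv))
        (Nbr-mono A⊆K) (λ v NJv → Nbr-mono J⊆K v (─-⊆ (Nbr J) (Nbr I) v NJv))
      K-bound : count K ≤ count A + count J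
      K-bound = ≤-trans (count-mono K⊆A∪J) (count-∪-≤ A J)
      lhs : ∀ z nk a ni na nj k → z + nk + (a + ni) + (na + nj) + k ≡ (z + (ni + nj)) + (nk + a + na + k)
      lhs = solve-∀
      rhs : ∀ k nz i na nk a j → k + nz + (i + na) + nk + (a + j) ≡ ((i + j) + nz) + (nk + a + na + k)
      rhs = solve-∀

  criticalIndependent⊆∪Nbr : ∀ I I′ → CriticalIndependent I → CriticalIndependent I′ →
    (∀ X → CriticalIndependent X → count X ≤ count I) → I′ ⊆ I ∪ Nbr I
  criticalIndependent⊆∪Nbr I I′ I-ci I′-ci I-max v I′v = ≢false⇒true λ IN[I]v →
    bool-contradiction (─-∈ I′ (I ∪ Nbr I) I′v IN[I]v) (count≡0⇒∅ J count-J≡0 v)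
    where
    open Extension I I′ I-ci I′-ci
    count-J≡0 : count J ≡ 0
    count-J≡0 = n≤0⇒n≡0 (+-cancelˡ-≤ (count I) (count J) 0 (subst₂ _≤_ count-I∪J (sym (+-identityʳ (count I)))
      (I-max (I ∪ J) (I∪J-independent , I∪J-critical))))

-- Hall's theorem

module Hall {n : ℕ} (G : Graph n) where

  open Independence G

  HallCondition : FSubset n → FSubset n → Set
  HallCondition P T = ∀ Y → Y ⊆ P → count Y ≤ count (Nbr Y ∩ T)

  MatchingInto : FSubset n → FSubset n → (Fin n → Fin n) → Set
  MatchingInto P T f = (∀ y → P y ≡ true → T (f y) ≡ true × adj G y (f y) ≡ true)
                     × (∀ y y′ → P y ≡ true → P y′ ≡ true → f y ≡ f y′ → y ≡ y′)

  matching-∅ : ∀ {P T} → (∀ v → P v ≡ false) → ∃[ f ] MatchingInto P T f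
  matching-∅ P≗∅ = (λ v → v) , (λ y Py → ⊥-elim (bool-contradiction Py (P≗∅ y)))
                             , (λ y _ Py _ _ → ⊥-elim (bool-contradiction Py (P≗∅ y)))

  matching-⁅⁆ : ∀ {p t} → adj G p t ≡ true → MatchingInto ⁅ p ⁆ ⁅ t ⁆ (λ _ → t)
  matching-⁅⁆ {p} {t} pt = (λ y y≡p → ==-refl t , subst (λ u → adj G u t ≡ true) (sym (==⇒≡ y≡p)) pt)
                         , (λ y y′ y≡p y′≡p _ → trans (==⇒≡ y≡p) (sym (==⇒≡ y′≡p)))

  matching-join : ∀ {P Y T₁ T₂ T f₁ f₂} → Disjoint T₁ T₂ → T₁ ⊆ T → T₂ ⊆ T →
    MatchingInto Y T₁ f₁ → MatchingInto (P ─ Y) T₂ f₂ →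
    MatchingInto P T (λ v → if Y v then f₁ v else f₂ v)
  matching-join {P} {Y} {T₁} {T₂} {T} {f₁} {f₂} T₁#T₂ T₁⊆T T₂⊆T (maps₁ , injective₁) (maps₂ , injective₂) =
    maps , injective
    where
    maps₂′ : ∀ {y} → P y ≡ true → Y y ≡ false → T₂ (f₂ y) ≡ true × adj G y (f₂ y) ≡ true
    maps₂′ Py Yy = maps₂ _ (─-∈ P Y Py Yy)
    maps : ∀ y → P y ≡ true → T (if Y y then f₁ y else f₂ y) ≡ true × adj G y (if Y y then f₁ y else f₂ y) ≡ true
    maps y Py with Y y in Yy
    ... | true  = let T₁f , adj₁ = maps₁ y Yy in T₁⊆T _ T₁f , adj₁
    ... | false = let T₂f , adj₂ = maps₂′ Py Yy in T₂⊆T _ T₂f , adj₂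
    injective : ∀ y y′ → P y ≡ true → P y′ ≡ true →
      (if Y y then f₁ y else f₂ y) ≡ (if Y y′ then f₁ y′ else f₂ y′) → y ≡ y′
    injective y y′ Py Py′ e with Y y in Yy | Y y′ in Yy′
    ... | true  | true  = injective₁ y y′ Yy Yy′ e
    ... | false | false = injective₂ y y′ (─-∈ P Y Py Yy) (─-∈ P Y Py′ Yy′) e
    ... | true  | false =
      ⊥-elim (T₁#T₂ _ (proj₁ (maps₁ y Yy)) (subst (λ u → T₂ u ≡ true) (sym e) (proj₁ (maps₂′ Py′ Yy′))))
    ... | false | true  =
      ⊥-elim (T₁#T₂ _ (proj₁ (maps₁ y′ Yy′)) (subst (λ u → T₂ u ≡ true) e (proj₁ (maps₂′ Py Yy))))

  -- Y ⊆ P is expressed through a count so that tightness is decidable.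
  Tight : FSubset n → FSubset n → FSubset n → Set
  Tight P T Y = (count (Y ─ P) ≡ 0) × (0 < count Y) × (count Y < count P) × (count (Nbr Y ∩ T) ≤ count Y)

  tight? : ∀ P T Y → Dec (Tight P T Y)
  tight? P T Y = (count (Y ─ P) ≟ 0) ×-dec (0 <? count Y) ×-dec (count Y <? count P) ×-dec (count (Nbr Y ∩ T) ≤? count Y)

  tight-cong : ∀ {P T Y Y′} → Y ≗ Y′ → Tight P T Y → Tight P T Y′
  tight-cong {P} {T} Y≗Y′ (a , b , c , d) =
    subst (_≡ 0) (count-cong λ v → cong (λ b → b ∧ not (P v)) (Y≗Y′ v)) a ,
    subst (0 <_) (count-cong Y≗Y′) b , subst (_< count P) (count-cong Y≗Y′) c ,
    subst₂ _≤_ (count-cong λ v → cong (_∧ T v) (Nbr-cong Y≗Y′ v)) (count-cong Y≗Y′) d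

  count─≡0⇒⊆ : ∀ {Y P : FSubset n} → count (Y ─ P) ≡ 0 → Y ⊆ P
  count─≡0⇒⊆ {Y} {P} z v Yv = ≢false⇒true λ Pv → bool-contradiction (─-∈ Y P Yv Pv) (count≡0⇒∅ (Y ─ P) z v)

  ⊆⇒count─≡0 : ∀ {Y P : FSubset n} → Y ⊆ P → count (Y ─ P) ≡ 0
  ⊆⇒count─≡0 {Y} {P} Y⊆P = trans (count-cong {g = ∅} λ v → ≢true⇒false λ e →
    bool-contradiction (Y⊆P v (─-⊆ Y P v e)) (─-∉ Y P v e)) (count-∅ {n})

  Hall : ℕ → Set
  Hall k = ∀ P T → count P ≤ k → HallCondition P T → ∃[ f ] MatchingInto P T f

  -- A tight set Y is matched into N(Y) ∩ T, and the rest of P into T ─ N(Y).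
  hall-tight : ∀ {k} → Hall k → ∀ P T Y → count P ≤ suc k → HallCondition P T → Tight P T Y →
    ∃[ f ] MatchingInto P T f
  hall-tight {k} IH P T Y |P|≤ hc (Y─P≡0 , 0<|Y| , |Y|<|P| , Y-tight) =
    _ , matching-join T₁#T₂ (∩-⊆ʳ (Nbr Y) T) (─-⊆ T (Nbr Y))
          (proj₂ (IH Y T₁ |Y|≤k hc₁)) (proj₂ (IH (P ─ Y) T₂ |P─Y|≤k hc₂))
    where
    T₁ T₂ : FSubset n
    T₁ = Nbr Y ∩ T
    T₂ = T ─ Nbr Y
    Y⊆P : Y ⊆ P
    Y⊆P = count─≡0⇒⊆ Y─P≡0
    T₁#T₂ : Disjoint T₁ T₂
    T₁#T₂ v T₁v T₂v = bool-contradiction (∧-trueˡ T₁v) (─-∉ T (Nbr Y) v T₂v)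
    |Y|≤k : count Y ≤ k
    |Y|≤k = ≤-pred (≤-trans |Y|<|P| |P|≤)
    |P|≡|Y|+|P─Y| : count P ≡ count Y + count (P ─ Y)
    |P|≡|Y|+|P─Y| = trans (count-split P Y) (cong (_+ count (P ─ Y)) (count-cong (∩-≗ʳ P Y Y⊆P)))
    |P─Y|≤k : count (P ─ Y) ≤ k
    |P─Y|≤k = ≤-pred (≤-trans (subst (suc (count (P ─ Y)) ≤_) (sym |P|≡|Y|+|P─Y|) (+-monoˡ-≤ _ 0<|Y|)) |P|≤)
    hc₁ : HallCondition Y T₁
    hc₁ Z Z⊆Y = ≤-trans (hc Z (λ v → Y⊆P v ∘ Z⊆Y v)) (count-mono λ v e →
      ∧-true⁺ {Nbr Z v} (∧-trueˡ e) (∧-true⁺ (Nbr-mono Z⊆Y v (∧-trueˡ e)) (∧-trueʳ {Nbr Z v} e)))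
    hc₂ : HallCondition (P ─ Y) T₂
    hc₂ Z Z⊆P─Y = +-cancelʳ-≤ (count Y) (count Z) (count (Nbr Z ∩ T₂)) (begin
      count Z + count Y                             ≡⟨ sym (count-disjoint-∪ Z#Y) ⟩
      count (Z ∪ Y)                                 ≤⟨ hc (Z ∪ Y) Z∪Y⊆P ⟩
      count (Nbr (Z ∪ Y) ∩ T)                       ≤⟨ count-mono Nbr-split ⟩
      count (T₁ ∪ (Nbr Z ∩ T₂))                     ≤⟨ count-∪-≤ T₁ (Nbr Z ∩ T₂) ⟩
      count T₁ + count (Nbr Z ∩ T₂)                 ≤⟨ +-monoˡ-≤ _ Y-tight ⟩
      count Y + count (Nbr Z ∩ T₂)                  ≡⟨ +-comm (count Y) _ ⟩
      count (Nbr Z ∩ T₂) + count Y                  ∎)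
      where
      open ≤-Reasoning
      Z#Y : Disjoint Z Y
      Z#Y v Zv Yv = bool-contradiction Yv (─-∉ P Y v (Z⊆P─Y v Zv))
      Z∪Y⊆P : Z ∪ Y ⊆ P
      Z∪Y⊆P v e = [ ─-⊆ P Y v ∘ Z⊆P─Y v , Y⊆P v ]′ (∨-true⁻ {Z v} e)
      Nbr-split : Nbr (Z ∪ Y) ∩ T ⊆ T₁ ∪ (Nbr Z ∩ T₂)
      Nbr-split v e = lemma (Nbr Y v) (Nbr Z v) (T v) (trans (sym (Nbr-∪ Z Y v)) (∧-trueˡ e)) (∧-trueʳ {Nbr (Z ∪ Y) v} e)
        where
        lemma : ∀ a b c → b ∨ a ≡ true → c ≡ true → (a ∧ c) ∨ (b ∧ (c ∧ not a)) ≡ true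
        lemma true  b     true _ _ = refl
        lemma false true  true _ _ = refl

  -- Without a tight set every Y has a surplus neighbour, so one edge p₀t may be removed.
  hall-slack : ∀ {k} → Hall k → ∀ P T {p₀} → count P ≤ suc k → HallCondition P T → P p₀ ≡ true →
    (∀ Y → ¬ Tight P T Y) → ∃[ f ] MatchingInto P T f
  hall-slack {k} IH P T {p₀} |P|≤ hc Pp₀ ∄tight =
    _ , matching-join {P} {⁅ p₀ ⁆} T₁#T₂
          (λ v t≡v → subst (λ u → T u ≡ true) (sym (==⇒≡ t≡v)) Tt) (─-⊆ T ⁅ t ⁆)
          (matching-⁅⁆ p₀t) (proj₂ (IH (P ─ ⁅ p₀ ⁆) (T ─ ⁅ t ⁆) |P′|≤k hc′))
    where
    t-exists : ∃[ t ] (Nbr ⁅ p₀ ⁆ ∩ T) t ≡ true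
    t-exists = count>0⇒∃ (Nbr ⁅ p₀ ⁆ ∩ T)
      (subst (_≤ count (Nbr ⁅ p₀ ⁆ ∩ T)) (count-⁅⁆ p₀)
        (hc ⁅ p₀ ⁆ λ v v≡p₀ → subst (λ u → P u ≡ true) (sym (==⇒≡ v≡p₀)) Pp₀))
    t : Fin n
    t = proj₁ t-exists
    Tt : T t ≡ true
    Tt = ∧-trueʳ {Nbr ⁅ p₀ ⁆ t} (proj₂ t-exists)
    p₀t : adj G p₀ t ≡ true
    p₀t with Nbr⁻ {⁅ p₀ ⁆} {t} (∧-trueˡ (proj₂ t-exists))
    ... | u , u≡p₀ , ut = subst (λ w → adj G w t ≡ true) (==⇒≡ u≡p₀) ut
    T₁#T₂ : Disjoint ⁅ t ⁆ (T ─ ⁅ t ⁆)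
    T₁#T₂ v v≡t e = bool-contradiction v≡t (─-∉ T ⁅ t ⁆ v e)
    |P′|≤k : count (P ─ ⁅ p₀ ⁆) ≤ k
    |P′|≤k = ≤-pred (≤-trans (count-─⁅⁆ P p₀ Pp₀) |P|≤)
    hc′ : HallCondition (P ─ ⁅ p₀ ⁆) (T ─ ⁅ t ⁆)
    hc′ Z Z⊆P′ with count Z ≟ 0
    ... | yes |Z|≡0 = subst (_≤ count (Nbr Z ∩ (T ─ ⁅ t ⁆))) (sym |Z|≡0) z≤n
    ... | no  |Z|≢0 = ≤-pred (≤-trans surplus
          (≤-trans (count≤suc-─⁅⁆ (Nbr Z ∩ T) t)
                   (s≤s (≤-reflexive (count-cong λ v → ∧-assoc (Nbr Z v) (T v) _)))))
      where
      Z⊆P : Z ⊆ P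
      Z⊆P v = ─-⊆ P ⁅ p₀ ⁆ v ∘ Z⊆P′ v
      surplus : count Z < count (Nbr Z ∩ T)
      surplus = ≰⇒> λ d → ∄tight Z
        (⊆⇒count─≡0 Z⊆P , n≢0⇒n>0 |Z|≢0 , ≤-<-trans (count-mono Z⊆P′) (count-─⁅⁆ P p₀ Pp₀) , d)

  hall : ∀ k → Hall k
  hall zero P T |P|≤0 hc = matching-∅ {T = T} (count≡0⇒∅ P (n≤0⇒n≡0 |P|≤0))
  hall (suc k) P T |P|≤ hc with FinP.any? (λ v → P v ≟ᵇ true)
  ... | no ∄p = matching-∅ {T = T} (λ v → ≢true⇒false λ Pv → ∄p (v , Pv))
  ... | yes (p₀ , Pp₀) with anySubset? (tight? P T ∘ lookup)
  ...   | yes (Y , Y-tight) = hall-tight (hall k) P T (lookup Y) |P|≤ hc Y-tight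
  ...   | no ∄tight = hall-slack (hall k) P T |P|≤ hc Pp₀ λ Y Y-tight →
          ∄tight (tabulate Y , tight-cong (sym ∘ lookup∘tabulate Y) Y-tight)

  hall-theorem : ∀ P T → HallCondition P T → ∃[ f ] MatchingInto P T f
  hall-theorem P T = hall n P T (count≤n P)

module _ {A B : Set} (g : A → Maybe B) where

  ∈-mapMaybe⁺ : ∀ {xs x y} → y ∈ xs → g y ≡ just x → x ∈ mapMaybe g xs
  ∈-mapMaybe⁺ {xs} {x} y∈ gy =
    AnyP.mapMaybe⁺ g xs (lose (∈-map⁺ g y∈) (subst (MaybeAny.Any (x ≡_)) (sym gy) (MaybeAny.just refl)))

  ∈-mapMaybe⁻ : ∀ xs {x} → x ∈ mapMaybe g xs → ∃[ y ] (y ∈ xs × g y ≡ just x)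
  ∈-mapMaybe⁻ (y ∷ ys) x∈ with g y in gy
  ... | nothing = let z , z∈ , gz = ∈-mapMaybe⁻ ys x∈ in z , there z∈ , gz
  ∈-mapMaybe⁻ (y ∷ ys) (here refl) | just _ = y , here refl , gy
  ∈-mapMaybe⁻ (y ∷ ys) (there x∈)  | just _ = let z , z∈ , gz = ∈-mapMaybe⁻ ys x∈ in z , there z∈ , gz

  mapMaybe-unique : ∀ {xs} → Unique xs → (∀ y y′ {x} → g y ≡ just x → g y′ ≡ just x → y ≡ y′) →
    Unique (mapMaybe g xs)
  mapMaybe-unique {[]}     _ _ = []
  mapMaybe-unique {y ∷ ys} (y∉ys ∷ ys-unique) g-inj with g y in gy
  ... | nothing = mapMaybe-unique ys-unique g-inj
  ... | just x  = All.tabulate (λ {x′} x′∈ x≡x′ → let z , z∈ , gz = ∈-mapMaybe⁻ ys x′∈ in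
                    All.lookup y∉ys z∈ (g-inj y z gy (subst (λ w → g z ≡ just w) (sym x≡x′) gz)))
                  ∷ mapMaybe-unique ys-unique g-inj

concatMap-unique : ∀ {A B : Set} (f : A → List B) {xs} → Unique xs → (∀ x → Unique (f x)) →
  (∀ {x x′ y} → y ∈ f x → y ∈ f x′ → x ≡ x′) → Unique (concatMap f xs)
concatMap-unique f {[]}     _ _ _ = []
concatMap-unique f {x ∷ xs} (x∉xs ∷ xs-unique) f-unique f-disjoint =
  UniqueP.++⁺ (f-unique x) (concatMap-unique f xs-unique f-unique f-disjoint) λ (y∈fx , y∈rest) →
    let x′ , x′∈ , y∈fx′ = find (∈-concatMap⁻ f {xs = xs} y∈rest) in
    All.lookup x∉xs x′∈ (f-disjoint y∈fx y∈fx′)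

module EdgeList {n : ℕ} (G : Graph n) where

  -- The entry function of `edges` is local to its definition; unification against the
  -- unfolded list recovers it.
  edgeAt : Fin n → Fin n → Maybe (Fin n × Fin n)
  edgeAt = recover refl
    where
    recover : ∀ {g} → edges G ≡ concatMap (λ u → mapMaybe (g u) (allFin n)) (allFin n) →
      Fin n → Fin n → Maybe (Fin n × Fin n)
    recover {g} _ = g

  edgeAt-just : ∀ u v {e} → edgeAt u v ≡ just e → e ≡ (u , v) × u Fin.< v × adj G u v ≡ true
  edgeAt-just u v e with u Fin.<? v | adj G u v
  edgeAt-just u v refl | yes u<v | true = refl , u<v , refl

  edgeAt-edge : ∀ {u v} → u Fin.< v → adj G u v ≡ true → edgeAt u v ≡ just (u , v)
  edgeAt-edge {u} {v} u<v uv with u Fin.<? v | adj G u v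
  ... | yes _   | true = refl
  ... | no  u≮v | _    = ⊥-elim (u≮v u<v)
  edgeAt-edge {u} {v} u<v () | yes _ | false

  private
    row : Fin n → List (Fin n × Fin n)
    row u = mapMaybe (edgeAt u) (allFin n)

    ∈-row⁻ : ∀ u {e} → e ∈ row u → ∃[ v ] (e ≡ (u , v) × u Fin.< v × adj G u v ≡ true)
    ∈-row⁻ u e∈ = let v , _ , uv = ∈-mapMaybe⁻ (edgeAt u) (allFin n) e∈ in v , edgeAt-just u v uv

  ∈-edges⁻ : ∀ {e} → e ∈ edges G → proj₁ e Fin.< proj₂ e × adj G (proj₁ e) (proj₂ e) ≡ true
  ∈-edges⁻ e∈ with find (∈-concatMap⁻ row {xs = allFin n} e∈)
  ... | u , _ , e∈row with ∈-row⁻ u e∈row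
  ...   | v , refl , u<v , uv = u<v , uv

  ∈-edges⁺ : ∀ {u v} → u Fin.< v → adj G u v ≡ true → (u , v) ∈ edges G
  ∈-edges⁺ {u} {v} u<v uv =
    ∈-concatMap⁺ row (lose (∈-allFin u) (∈-mapMaybe⁺ (edgeAt u) (∈-allFin v) (edgeAt-edge u<v uv)))

  edges-unique : Unique (edges G)
  edges-unique = concatMap-unique row (UniqueP.allFin⁺ n) row-unique λ {u} {u′} e∈u e∈u′ →
    trans (sym (first u e∈u)) (first u′ e∈u′)
    where
    row-unique : ∀ u → Unique (row u)
    row-unique u = mapMaybe-unique (edgeAt u) (UniqueP.allFin⁺ n) λ v v′ e e′ →
      cong proj₂ (trans (sym (proj₁ (edgeAt-just u v e))) (proj₁ (edgeAt-just u v′ e′)))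
    first : ∀ u {e} → e ∈ row u → proj₁ e ≡ u
    first u e∈ with ∈-row⁻ u e∈
    ... | _ , refl , _ = refl

module _ {A : Set} (p : A → Bool) where

  length-filter-∷ : ∀ x xs → length (filter (T? ∘ p) xs) ≤ length (filter (T? ∘ p) (x ∷ xs))
  length-filter-∷ x xs with p x
  ... | true  = n≤1+n _
  ... | false = ≤-refl

  length-filter≡0⇒any≡false : ∀ xs → length (filter (T? ∘ p) xs) ≡ 0 → any p xs ≡ false
  length-filter≡0⇒any≡false []       _ = refl
  length-filter≡0⇒any≡false (x ∷ xs) e with p x
  ... | true  = case e of λ ()
  ... | false = length-filter≡0⇒any≡false xs e

  filter∈sublists : ∀ xs → filter (T? ∘ p) xs ∈ sublists xs
  filter∈sublists []       = here refl
  filter∈sublists (x ∷ xs) with p x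
  ... | true  = ∈-++⁺ʳ (sublists xs) (∈-map⁺ (x ∷_) (filter∈sublists xs))
  ... | false = ∈-++⁺ˡ (filter∈sublists xs)

module _ {A : Set} where

  []∈sublists : ∀ (xs : List A) → [] ∈ sublists xs
  []∈sublists []       = here refl
  []∈sublists (x ∷ xs) = ∈-++⁺ˡ ([]∈sublists xs)

  ∈-sublists⇒⊆ : ∀ (xs : List A) {ys y} → ys ∈ sublists xs → y ∈ ys → y ∈ xs
  ∈-sublists⇒⊆ []       (here refl) ()
  ∈-sublists⇒⊆ (x ∷ xs) ys∈ y∈ with ∈-++⁻ (sublists xs) ys∈
  ... | inj₁ ys∈′ = there (∈-sublists⇒⊆ xs ys∈′ y∈)
  ... | inj₂ x∷ys∈ with ∈-map⁻ (x ∷_) x∷ys∈ | y∈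
  ...   | ys′ , ys′∈ , refl | here refl = here refl
  ...   | ys′ , ys′∈ , refl | there y∈′ = there (∈-sublists⇒⊆ xs ys′∈ y∈′)

  unique-constant⇒length≤1 : ∀ (xs : List A) → Unique xs →
    (∀ {x y} → x ∈ xs → y ∈ xs → x ≡ y) → length xs ≤ 1
  unique-constant⇒length≤1 []          _ _ = z≤n
  unique-constant⇒length≤1 (x ∷ [])    _ _ = s≤s z≤n
  unique-constant⇒length≤1 (x ∷ y ∷ _) ((x≢y All.∷ _) ∷ _) const =
    ⊥-elim (x≢y (const (here refl) (there (here refl))))

module Matchings {n : ℕ} (G : Graph n) where

  open Independence G
  open EdgeList G

  Edge : Set
  Edge = Fin n × Fin n

  ends : Edge → FSubset n
  ends e w = endpointOf G w e

  covered : List Edge → FSubset n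
  covered M w = any (endpointOf G w) M

  incident : Fin n → List Edge → List Edge
  incident w = filter (T? ∘ endpointOf G w)

  IsMatching : List Edge → Set
  IsMatching M = ∀ w → length (incident w M) ≤ 1

  GraphEdges : List Edge → Set
  GraphEdges M = ∀ {e} → e ∈ M → proj₁ e ≢ proj₂ e × adj G (proj₁ e) (proj₂ e) ≡ true

  isMatching⁻ : ∀ M → isMatching G M ≡ true → IsMatching M
  isMatching⁻ M e w = ≤ᵇ⇒≤ _ 1 (≡true⇒T (all-≡true⁻ _ (allFin n) e (∈-allFin w)))

  isMatching⁺ : ∀ M → IsMatching M → isMatching G M ≡ true
  isMatching⁺ M h = all-≡true⁺ _ (allFin n) λ {w} _ → T⇒≡true (≤⇒≤ᵇ (h w))

  IsMatching-∷ : ∀ {e M} → IsMatching (e ∷ M) → IsMatching M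
  IsMatching-∷ {e} {M} h w = ≤-trans (length-filter-∷ (endpointOf G w) e M) (h w)

  GraphEdges-∷ : ∀ {e M} → GraphEdges (e ∷ M) → GraphEdges M
  GraphEdges-∷ ok = ok ∘ there

  sublist-graphEdges : ∀ {M} → M ∈ sublists (edges G) → GraphEdges M
  sublist-graphEdges M∈ e∈ = let u<v , uv = ∈-edges⁻ (∈-sublists⇒⊆ (edges G) M∈ e∈) in FinP.<⇒≢ u<v , uv

  ends⁻ : ∀ {w a b} → ends (a , b) w ≡ true → w ≡ a ⊎ w ≡ b
  ends⁻ {w} {a} e = [ inj₁ ∘ ==⇒≡ , inj₂ ∘ ==⇒≡ ]′ (∨-true⁻ {w == a} e)

  count-ends : ∀ {a b} → a ≢ b → count (ends (a , b)) ≡ 2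
  count-ends {a} {b} a≢b =
    trans (count-disjoint-∪ {f = ⁅ a ⁆} {⁅ b ⁆} λ w w≡a w≡b → a≢b (trans (sym (==⇒≡ w≡a)) (==⇒≡ w≡b)))
                                 (cong₂ _+_ (count-⁅⁆ a) (count-⁅⁆ b))

  ∷-uncovered : ∀ {e M w} → IsMatching (e ∷ M) → ends e w ≡ true → covered M w ≡ false
  ∷-uncovered {e} {M} {w} h we = length-filter≡0⇒any≡false (endpointOf G w) M (n≤0⇒n≡0 (≤-pred
    (subst (λ l → length l ≤ 1) (filter-accept (T? ∘ endpointOf G w) (≡true⇒T we)) (h w))))

  count-covered : ∀ M → GraphEdges M → IsMatching M → count (covered M) ≡ length M + length M
  count-covered []            _  _ = count-∅ {n}
  count-covered ((a , b) ∷ M) ok h = begin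
    count (ends (a , b) ∪ covered M)
      ≡⟨ count-disjoint-∪ {f = ends (a , b)} {covered M} (λ w we wc → bool-contradiction wc (∷-uncovered {w = w} h we)) ⟩
    count (ends (a , b)) + count (covered M)
      ≡⟨ cong₂ _+_ (count-ends (proj₁ (ok (here refl)))) (count-covered M (GraphEdges-∷ ok) (IsMatching-∷ h)) ⟩
    2 + (length M + length M)                  ≡⟨ cong suc (sym (+-suc (length M) (length M))) ⟩
    suc (length M) + suc (length M)            ∎
    where open ≡-Reasoning

  count-ends∩independent : ∀ {a b} S → adj G a b ≡ true → Independent S → count (ends (a , b) ∩ S) ≤ 1
  count-ends∩independent {a} {b} S ab S-ind with S a in Sa
  ... | true  = subst (count (ends (a , b) ∩ S) ≤_) (count-⁅⁆ a) (count-mono only-a)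
    where
    only-a : ends (a , b) ∩ S ⊆ ⁅ a ⁆
    only-a w e with ends⁻ {w} (∧-trueˡ e)
    ... | inj₁ refl = ==-refl w
    ... | inj₂ refl = ⊥-elim (bool-contradiction ab (S-ind a w Sa (∧-trueʳ {ends (a , w) w} e)))
  ... | false = subst (count (ends (a , b) ∩ S) ≤_) (count-⁅⁆ b) (count-mono only-b)
    where
    only-b : ends (a , b) ∩ S ⊆ ⁅ b ⁆
    only-b w e with ends⁻ {w} (∧-trueˡ e)
    ... | inj₁ refl = ⊥-elim (bool-contradiction (∧-trueʳ {ends (w , b) w} e) Sa)
    ... | inj₂ refl = ==-refl w

  private
    count-covered-∷∩ : ∀ e M S → count (covered (e ∷ M) ∩ S) ≤ count (ends e ∩ S) + count (covered M ∩ S)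
    count-covered-∷∩ e M S =
      ≤-trans (count-mono (∪-∩-⊆ (ends e) (covered M) S)) (count-∪-≤ (ends e ∩ S) (covered M ∩ S))

  count-covered∩independent : ∀ M S → GraphEdges M → Independent S → count (covered M ∩ S) ≤ length M
  count-covered∩independent []            S _  _     = ≤-reflexive (count-∅ {n})
  count-covered∩independent ((a , b) ∷ M) S ok S-ind = ≤-trans (count-covered-∷∩ (a , b) M S)
    (+-mono-≤ (count-ends∩independent S (proj₂ (ok (here refl))) S-ind)
              (count-covered∩independent M S (GraphEdges-∷ ok) S-ind))

  count-covered∩independent-< : ∀ M S → GraphEdges M → Independent S → ∀ {a b} → (a , b) ∈ M →
    S a ≡ false → S b ≡ false → count (covered M ∩ S) < length M
  count-covered∩independent-< ((a , b) ∷ M) S ok S-ind (here refl) Sa Sb =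
    s≤s (≤-trans (count-mono ⊆-tail) (count-covered∩independent M S (GraphEdges-∷ ok) S-ind))
    where
    ⊆-tail : covered ((a , b) ∷ M) ∩ S ⊆ covered M ∩ S
    ⊆-tail w e with ∨-true⁻ (∪-∩-⊆ (ends (a , b)) (covered M) S w e)
    ... | inj₂ in-tail = in-tail
    ... | inj₁ in-head with ends⁻ {w} (∧-trueˡ in-head)
    ...   | inj₁ refl = ⊥-elim (bool-contradiction (∧-trueʳ {ends (a , b) a} in-head) Sa)
    ...   | inj₂ refl = ⊥-elim (bool-contradiction (∧-trueʳ {ends (a , b) b} in-head) Sb)
  count-covered∩independent-< ((a′ , b′) ∷ M) S ok S-ind (there ab∈) Sa Sb = s≤s (≤-trans
    (count-covered-∷∩ (a′ , b′) M S)
    (≤-trans (+-monoˡ-≤ (count (covered M ∩ S)) (count-ends∩independent S (proj₂ (ok (here refl))) S-ind))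
             (count-covered∩independent-< M S (GraphEdges-∷ ok) S-ind ab∈ Sa Sb)))

  length≤count∁ : ∀ M S → GraphEdges M → IsMatching M → Independent S → length M ≤ count (∁ S)
  length≤count∁ M S ok h S-ind = +-cancelˡ-≤ (length M) (length M) (count (∁ S)) (begin
    length M + length M                           ≡⟨ sym (count-covered M ok h) ⟩
    count (covered M)                             ≡⟨ count-split (covered M) S ⟩
    count (covered M ∩ S) + count (covered M ─ S)
      ≤⟨ +-mono-≤ (count-covered∩independent M S ok S-ind) (count-mono λ w → ∧-trueʳ {covered M w}) ⟩
    length M + count (∁ S)                        ∎)
    where open ≤-Reasoning

  partner : Fin n → List Edge → Fin n
  partner w []            = w
  partner w ((a , b) ∷ M) = if w == a then b else if w == b then a else partner w M

  partner-∈ : ∀ M {w} → covered M w ≡ true → (w , partner w M) ∈ M ⊎ (partner w M , w) ∈ M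
  partner-∈ ((a , b) ∷ M) {w} c with w == a in wa | w == b in wb
  ... | true  | _     = inj₁ (here (cong (_, b) (==⇒≡ wa)))
  ... | false | true  = inj₂ (here (cong (a ,_) (==⇒≡ wb)))
  ... | false | false = [ inj₁ ∘ there , inj₂ ∘ there ]′ (partner-∈ M c)

  partner-adjacent : ∀ M {w} → GraphEdges M → covered M w ≡ true → adj G w (partner w M) ≡ true
  partner-adjacent M {w} ok c with partner-∈ M c
  ... | inj₁ e∈ = proj₂ (ok e∈)
  ... | inj₂ e∈ = trans (adj-sym G w (partner w M)) (proj₂ (ok e∈))

  partner-covered : ∀ M {w} → covered M w ≡ true → covered M (partner w M) ≡ true
  partner-covered M {w} c with partner-∈ M c
  ... | inj₁ e∈ = any-≡true⁺ (endpointOf G (partner w M)) M e∈ (∨-trueʳ {partner w M == w} (==-refl (partner w M)))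
  ... | inj₂ e∈ = any-≡true⁺ (endpointOf G (partner w M)) M e∈ (∨-trueˡ (==-refl (partner w M)))

  partner-involutive : ∀ M {w} → GraphEdges M → IsMatching M → covered M w ≡ true → partner (partner w M) M ≡ w
  partner-involutive ((a , b) ∷ M) {w} ok h c with w == a in wa | w == b in wb
  ... | true | _ rewrite ≢⇒==false (λ b≡a → proj₁ (ok (here refl)) (sym b≡a)) | ==-refl b = sym (==⇒≡ wa)
  ... | false | true rewrite ==-refl a = sym (==⇒≡ wb)
  ... | false | false = trans skip-head (partner-involutive M (GraphEdges-∷ ok) (IsMatching-∷ h) c)
    where
    p : Fin n
    p = partner w M
    p-covered : covered M p ≡ true
    p-covered = partner-covered M c
    p≢a : p ≢ a
    p≢a p≡a = bool-contradiction (subst (λ x → covered M x ≡ true) p≡a p-covered)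
                                 (∷-uncovered {w = a} h (∨-trueˡ (==-refl a)))
    p≢b : p ≢ b
    p≢b p≡b = bool-contradiction (subst (λ x → covered M x ≡ true) p≡b p-covered)
                                 (∷-uncovered {w = b} h (∨-trueʳ {b == a} (==-refl b)))
    skip-head : partner p ((a , b) ∷ M) ≡ partner p M
    skip-head rewrite ≢⇒==false p≢a | ≢⇒==false p≢b = refl

  private
    size∈ : ∀ {M} → M ∈ sublists (edges G) → IsMatching M →
      length M ∈ map length (filter (T? ∘ isMatching G) (sublists (edges G)))
    size∈ {M} M∈ M-matching =
      ∈-map⁺ length (∈-filter⁺ (T? ∘ isMatching G) M∈ (≡true⇒T (isMatching⁺ M M-matching)))

  μ-upper : ∀ {M} → M ∈ sublists (edges G) → IsMatching M → length M ≤ μ G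
  μ-upper M∈ M-matching = maxℕ-upper _ (size∈ M∈ M-matching)

  μ-least : ∀ b → (∀ {M} → M ∈ sublists (edges G) → IsMatching M → length M ≤ b) → μ G ≤ b
  μ-least b h = maxℕ-least _ b λ l∈ →
    let M , M∈ , l≡ = ∈-map⁻ length l∈
        M∈sub , M-matching = ∈-filter⁻ (T? ∘ isMatching G) {xs = sublists (edges G)} M∈
    in subst (_≤ b) (sym l≡) (h M∈sub (isMatching⁻ M (T⇒≡true M-matching)))

  opaque
    μ-attained : ∃[ M ] (M ∈ sublists (edges G) × IsMatching M × length M ≡ μ G)
    μ-attained with ∈-map⁻ length (maxℕ-∈ _ (size∈ {[]} ([]∈sublists (edges G)) (λ _ → z≤n)))
    ... | M , M∈ , μ≡ = let M∈sub , M-matching = ∈-filter⁻ (T? ∘ isMatching G) {xs = sublists (edges G)} M∈ in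
      M , M∈sub , isMatching⁻ M (T⇒≡true M-matching) , sym μ≡

module Numbers {n : ℕ} (G : Graph n) where

  open Independence G
  open CriticalSets G

  α-upper : ∀ X → Independent X → count X ≤ α G
  α-upper X X-ind = subst (_≤ α G) (∣tabulate∣≡count X)
    (maxSize-upper (independent G) (tabulate X) (independent-tabulate X X-ind))

  -- The witnesses below are opaque: unfolding them in later conversion checks exhausts memory.
  opaque
    α-attained : ∃[ S ] (independent G S ≡ true × ∣ S ∣ ≡ α G)
    α-attained = maxSize-attained (independent G) (tabulate ∅) (independent-tabulate ∅ λ _ _ ())

  maxCritSize-upper : ∀ X → CriticalIndependent X → count X ≤ maxCritSize G
  maxCritSize-upper X X-ci = subst (_≤ maxCritSize G) (∣tabulate∣≡count X)
    (maxSize-upper (criticalIndependent G) (tabulate X) (criticalIndependent-tabulate X X-ci))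

  opaque
    maxCritSize-attained : ∃[ S ] (criticalIndependent G S ≡ true × ∣ S ∣ ≡ maxCritSize G)
    maxCritSize-attained with dmax-attained
    ... | S₀ , dmax≡dS₀ = maxSize-attained (criticalIndependent G) (tabulate R) (criticalIndependent-tabulate R
            (─Nbr-independent (lookup S₀) , critical-─Nbr (lookup S₀) (critical⁻ S₀ (sym dmax≡dS₀))))
      where
      R : FSubset n
      R = lookup S₀ ─ Nbr (lookup S₀)

  maxCritical-exists : ∃[ S ] maxCriticalIndependent G S ≡ true
  maxCritical-exists with maxCritSize-attained
  ... | S , S-ci , |S|≡c = S , ∧-true⁺ S-ci (T⇒≡true (≡⇒≡ᵇ _ _ |S|≡c))

  maxCritSize≤α : maxCritSize G ≤ α G
  maxCritSize≤α with maxCritSize-attained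
  ... | S , S-ci , |S|≡c = subst (_≤ α G) (trans (sym (∣∣≡count S)) |S|≡c)
          (α-upper (lookup S) (proj₁ (criticalIndependent⁻ S S-ci)))

  maxIndependent⇒Nbr≗∁ : ∀ S → Independent S → count S ≡ α G → Nbr S ≗ ∁ S
  maxIndependent⇒Nbr≗∁ S S-ind |S|≡α v with S v in Sv
  ... | true  = independent⇒∉Nbr S-ind v Sv
  ... | false = ≢false⇒true λ NSv → 1+n≰n (subst (_≤ α G) |S∪v| (α-upper (S ∪ ⁅ v ⁆) (S∪v-independent NSv)))
    where
    |S∪v| : count (S ∪ ⁅ v ⁆) ≡ suc (α G)
    |S∪v| = trans (count-disjoint-∪ {f = S} {⁅ v ⁆}
                    (λ w Sw w≡v → bool-contradiction (subst (λ u → S u ≡ true) (==⇒≡ w≡v) Sw) Sv))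
                  (trans (cong₂ _+_ |S|≡α (count-⁅⁆ v)) (+-comm (α G) 1))
    S∪v-independent : Nbr S v ≡ false → Independent (S ∪ ⁅ v ⁆)
    S∪v-independent NSv u w Su Sw with ∨-true⁻ {S u} Su | ∨-true⁻ {S w} Sw
    ... | inj₁ Su′ | inj₁ Sw′ = S-ind u w Su′ Sw′
    ... | inj₁ Su′ | inj₂ w≡v = ≢true⇒false λ uw →
      bool-contradiction (Nbr⁺ Su′ (subst (λ x → adj G u x ≡ true) (==⇒≡ w≡v) uw)) NSv
    ... | inj₂ u≡v | inj₁ Sw′ = ≢true⇒false λ uw →
      bool-contradiction (Nbr⁺ Sw′ (subst (λ x → adj G w x ≡ true) (==⇒≡ u≡v) (trans (adj-sym G w u) uw))) NSv
    ... | inj₂ u≡v | inj₂ w≡v =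
      subst (λ x → adj G u x ≡ false) (trans (==⇒≡ u≡v) (sym (==⇒≡ w≡v))) (adj-irr G u)

  count-Nbr-maxIndependent : ∀ S → Independent S → count S ≡ α G → count (Nbr S) + α G ≡ n
  count-Nbr-maxIndependent S S-ind |S|≡α = begin
    count (Nbr S) + α G   ≡⟨ cong₂ _+_ (count-cong (maxIndependent⇒Nbr≗∁ S S-ind |S|≡α)) (sym |S|≡α) ⟩
    count (∁ S) + count S ≡⟨ +-comm (count (∁ S)) (count S) ⟩
    count S + count (∁ S) ≡⟨ count-∁ S ⟩
    n                     ∎
    where open ≡-Reasoning

module ComplementMatching {n : ℕ} (G : Graph n) (S : FSubset n) (m : Fin n → Fin n)
  (m-into : ∀ w → S w ≡ false → S (m w) ≡ true)
  (m-adj  : ∀ w → S w ≡ false → adj G w (m w) ≡ true)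
  (m-inj  : ∀ w w′ → S w ≡ false → S w′ ≡ false → m w ≡ m w′ → w ≡ w′) where

  open Independence G
  open CriticalSets G

  private
    count-≤-via-m : ∀ A B → (∀ w → A w ≡ true → S w ≡ false) → (∀ w → A w ≡ true → B (m w) ≡ true) →
      count A ≤ count B
    count-≤-via-m A B A∩S≡∅ maps = count-≤-injection A B m maps
      λ w w′ Aw Aw′ → m-inj w w′ (A∩S≡∅ w Aw) (A∩S≡∅ w′ Aw′)

  d-bound-independent : ∀ Z → Independent Z → count Z + count (∁ S) ≤ count S + count (Nbr Z)
  d-bound-independent Z Z-ind = begin
    count Z + count (∁ S)
      ≡⟨ cong₂ _+_ (count-split Z S) split-∁S ⟩
    (count (Z ∩ S) + count (Z ─ S)) + (count (Z ─ S) + (count (Q ∩ Nbr Z) + count R))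
      ≡⟨ regroupˡ (count (Z ∩ S)) (count (Z ─ S)) (count (Q ∩ Nbr Z)) (count R) ⟩
    count (Z ∩ S) + (count (Z ─ S) + ((count (Z ─ S) + count R) + count (Q ∩ Nbr Z)))
      ≤⟨ +-monoʳ-≤ (count (Z ∩ S)) (+-mono-≤ ZN≤NZS (+-mono-≤ ZN+R≤SN QN≤NZN)) ⟩
    count (Z ∩ S) + (count (Nbr Z ∩ S) + (count (S ─ Z) + count (Nbr Z ─ S)))
      ≡⟨ regroupʳ (count (Z ∩ S)) (count (Nbr Z ∩ S)) (count (S ─ Z)) (count (Nbr Z ─ S)) ⟩
    (count (Z ∩ S) + count (S ─ Z)) + (count (Nbr Z ∩ S) + count (Nbr Z ─ S))
      ≡⟨ cong₂ _+_ split-S (sym (count-split (Nbr Z) S)) ⟩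
    count S + count (Nbr Z)
    ∎
    where
    open ≤-Reasoning
    Q R : FSubset n
    Q = ∁ S ─ Z
    R = Q ─ Nbr Z
    split-∁S : count (∁ S) ≡ count (Z ─ S) + (count (Q ∩ Nbr Z) + count R)
    split-∁S = trans (count-split (∁ S) Z) (cong₂ _+_ (count-cong λ w → ∧-comm (not (S w)) (Z w)) (count-split Q (Nbr Z)))
    split-S : count (Z ∩ S) + count (S ─ Z) ≡ count S
    split-S = sym (trans (count-split S Z) (cong (_+ count (S ─ Z)) (count-cong λ w → ∧-comm (S w) (Z w))))
    regroupˡ : ∀ a b c d → (a + b) + (b + (c + d)) ≡ a + (b + ((b + d) + c))
    regroupˡ = solve-∀
    regroupʳ : ∀ a b c d → a + (b + (c + d)) ≡ (a + c) + (b + d)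
    regroupʳ = solve-∀
    ZN≤NZS : count (Z ─ S) ≤ count (Nbr Z ∩ S)
    ZN≤NZS = count-≤-via-m (Z ─ S) (Nbr Z ∩ S) (─-∉ Z S) λ w ZNw →
      ∧-true⁺ (Nbr⁺ (─-⊆ Z S w ZNw) (m-adj w (─-∉ Z S w ZNw))) (m-into w (─-∉ Z S w ZNw))
    R-∉S : ∀ w → R w ≡ true → S w ≡ false
    R-∉S w Rw = not-true⁻ (∧-trueˡ (─-⊆ Q (Nbr Z) w Rw))
    ZN+R≤SN : count (Z ─ S) + count R ≤ count (S ─ Z)
    ZN+R≤SN = subst (_≤ count (S ─ Z))
      (count-disjoint-∪ λ w ZNw Rw → bool-contradiction (─-⊆ Z S w ZNw) (─-∉ (∁ S) Z w (─-⊆ Q (Nbr Z) w Rw)))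
      (count-≤-via-m ((Z ─ S) ∪ R) (S ─ Z) ∉S λ w e → ─-∈ S Z (m-into w (∉S w e)) (m∉Z w e))
      where
      ∉S : ∀ w → ((Z ─ S) ∪ R) w ≡ true → S w ≡ false
      ∉S w e = [ ─-∉ Z S w , R-∉S w ]′ (∨-true⁻ {(Z ─ S) w} e)
      m∉Z : ∀ w → ((Z ─ S) ∪ R) w ≡ true → Z (m w) ≡ false
      m∉Z w e with ∨-true⁻ {(Z ─ S) w} e
      ... | inj₁ ZNw = ≢true⇒false λ Zmw → bool-contradiction (m-adj w (∉S w e)) (Z-ind w (m w) (─-⊆ Z S w ZNw) Zmw)
      ... | inj₂ Rw  = ≢true⇒false λ Zmw →
        bool-contradiction (Nbr⁺ Zmw (trans (adj-sym G (m w) w) (m-adj w (∉S w e)))) (─-∉ Q (Nbr Z) w Rw)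
    QN≤NZN : count (Q ∩ Nbr Z) ≤ count (Nbr Z ─ S)
    QN≤NZN = count-mono λ w e → ∧-true⁺ (∧-trueʳ {Q w} e) (∧-trueˡ (∧-trueˡ e))

  d-bound : ∀ Y → count Y + count (∁ S) ≤ count S + count (Nbr Y)
  d-bound Y = ≤-by-sum (d≤d-─Nbr Y) (d-bound-independent R (─Nbr-independent Y))
    (lhs (count Y) (count (Nbr R)) (count R) (count (∁ S)))
    (rhs (count R) (count (Nbr Y)) (count S) (count (Nbr R)))
    where
    R : FSubset n
    R = Y ─ Nbr Y
    lhs : ∀ y nr r ns → y + nr + (r + ns) ≡ (y + ns) + (nr + r)
    lhs = solve-∀
    rhs : ∀ r ny s nr → r + ny + (s + nr) ≡ (s + ny) + (nr + r)
    rhs = solve-∀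

-- König–Egerváry graphs

module KönigEgervárySets {n : ℕ} (G : Graph n) where

  open Independence G
  open Matchings G
  open Numbers G

  module SaturatedComplement (M : List Edge) (S : FSubset n) (ok : GraphEdges M) (M-matching : IsMatching M)
    (S-ind : Independent S) (|M|≡|∁S| : length M ≡ count (∁ S)) where

    private
      L cs cn : ℕ
      L = length M
      cs = count (covered M ∩ S)
      cn = count (covered M ─ S)
      cs+cn≡L+L : cs + cn ≡ L + L
      cs+cn≡L+L = trans (sym (count-split (covered M) S)) (count-covered M ok M-matching)
      cn≤L : cn ≤ L
      cn≤L = subst (cn ≤_) (sym |M|≡|∁S|) (count-mono λ w → ∧-trueʳ {covered M w})
      L≤cn : L ≤ cn
      L≤cn = +-cancelˡ-≤ L L cn (subst (_≤ L + cn) cs+cn≡L+L (+-monoˡ-≤ cn (count-covered∩independent M S ok S-ind)))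

    ∁S⊆covered : ∀ w → S w ≡ false → covered M w ≡ true
    ∁S⊆covered w Sw = ≢false⇒true λ cw → 1+n≰n (≤-trans (s≤s L≤cn) (subst (suc cn ≤_) (sym |M|≡|∁S|)
      (count-mono-< (λ u → ∧-trueʳ {covered M u}) w (not-true⁺ Sw) (cong (_∧ not (S w)) cw))))

    edge-meets-S : ∀ {a b} → (a , b) ∈ M → S a ≡ true ⊎ S b ≡ true
    edge-meets-S {a} {b} ab∈ with S a in Sa | S b in Sb
    ... | true  | _    = inj₁ refl
    ... | false | true = inj₂ refl
    ... | false | false = ⊥-elim (1+n≰n (≤-trans L<cn cn≤L))
      where
      L<cn : L < cn
      L<cn = +-cancelˡ-≤ cs (suc L) cn (subst (cs + suc L ≤_) (sym cs+cn≡L+L)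
        (subst (_≤ L + L) (sym (+-suc cs L)) (+-monoˡ-≤ L (count-covered∩independent-< M S ok S-ind ab∈ Sa Sb))))

    partner-into : ∀ w → S w ≡ false → S (partner w M) ≡ true
    partner-into w Sw with partner-∈ M (∁S⊆covered w Sw)
    ... | inj₁ e∈ = [ (λ Sw′ → ⊥-elim (bool-contradiction Sw′ Sw)) , (λ S-partner → S-partner) ]′ (edge-meets-S e∈)
    ... | inj₂ e∈ = [ (λ S-partner → S-partner) , (λ Sw′ → ⊥-elim (bool-contradiction Sw′ Sw)) ]′ (edge-meets-S e∈)

    partner-injective : ∀ w w′ → S w ≡ false → S w′ ≡ false → partner w M ≡ partner w′ M → w ≡ w′
    partner-injective w w′ Sw Sw′ e = begin
      w                              ≡⟨ sym (partner-involutive M ok M-matching (∁S⊆covered w Sw)) ⟩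
      partner (partner w M) M        ≡⟨ cong (λ x → partner x M) e ⟩
      partner (partner w′ M) M       ≡⟨ partner-involutive M ok M-matching (∁S⊆covered w′ Sw′) ⟩
      w′                             ∎
      where open ≡-Reasoning

  KönigEgerváry⇒maxCritSize≡α : KönigEgerváry G → maxCritSize G ≡ α G
  KönigEgerváry⇒maxCritSize≡α ke with α-attained | μ-attained
  ... | S′ , S′-ind , |S′|≡α | M , M∈ , M-matching , |M|≡μ =
    ≤-antisym maxCritSize≤α (subst (_≤ maxCritSize G) |S|≡α (maxCritSize-upper S (S-ind , S-critical)))
    where
    S : FSubset n
    S = lookup S′
    S-ind : Independent S
    S-ind = independent⁻ S′ S′-ind
    |S|≡α : count S ≡ α G
    |S|≡α = trans (sym (∣∣≡count S′)) |S′|≡α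
    |M|≡|∁S| : length M ≡ count (∁ S)
    |M|≡|∁S| = trans |M|≡μ (+-cancelˡ-≡ (α G) (μ G) (count (∁ S))
      (trans ke (sym (trans (cong (_+ count (∁ S)) (sym |S|≡α)) (count-∁ S)))))
    ok : GraphEdges M
    ok = sublist-graphEdges M∈
    open SaturatedComplement M S ok M-matching S-ind |M|≡|∁S|
    open ComplementMatching G S (λ w → partner w M) partner-into
      (λ w Sw → partner-adjacent M ok (∁S⊆covered w Sw)) partner-injective
    S-critical : Critical S
    S-critical Y = subst (λ c → count Y + c ≤ count S + count (Nbr Y))
      (sym (count-cong (maxIndependent⇒Nbr≗∁ S S-ind |S|≡α))) (d-bound Y)

module MaximumCritical {n : ℕ} (G : Graph n) (I′ : Subset n) (I′-max : maxCriticalIndependent G I′ ≡ true) where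

  open Independence G
  open CriticalSets G
  open Hall G
  open Numbers G
  open EdgeList G
  open Matchings G

  I : FSubset n
  I = lookup I′

  I-ci : CriticalIndependent I
  I-ci = criticalIndependent⁻ I′ (∧-trueˡ I′-max)

  I-ind : Independent I
  I-ind = proj₁ I-ci

  |I|≡maxCritSize : count I ≡ maxCritSize G
  |I|≡maxCritSize =
    trans (sym (∣∣≡count I′)) (≡ᵇ⇒≡ _ _ (≡true⇒T (∧-trueʳ {criticalIndependent G I′} I′-max)))

  I-maximum : ∀ X → CriticalIndependent X → count X ≤ count I
  I-maximum X X-ci = subst (count X ≤_) (sym |I|≡maxCritSize) (maxCritSize-upper X X-ci)

  hallCondition : HallCondition (Nbr I) I
  hallCondition Y Y⊆NI = ≤-by-sum (+-mono-≤ (proj₂ I-ci A) NA+Y≤NI) (≤-reflexive split-I)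
    (lhs (count A) (count (Nbr I)) (count (Nbr A)) (count Y) (count I))
    (rhs (count I) (count (Nbr A)) (count (Nbr I)) (count (Nbr Y ∩ I)) (count A))
    where
    A : FSubset n
    A = I ─ Nbr Y
    NA+Y≤NI : count (Nbr A) + count Y ≤ count (Nbr I)
    NA+Y≤NI = count-disjoint-≤
      (λ v NAv Yv → let u , Au , uv = Nbr⁻ NAv in
        bool-contradiction (Nbr⁺ Yv (trans (adj-sym G v u) uv)) (─-∉ I (Nbr Y) u Au))
      (Nbr-mono (─-⊆ I (Nbr Y))) Y⊆NI
    split-I : count I ≡ count (Nbr Y ∩ I) + count A
    split-I = trans (count-split I (Nbr Y)) (cong (_+ count A) (count-cong λ v → ∧-comm (I v) (Nbr Y v)))
    lhs : ∀ a ni na y i → a + ni + (na + y) + i ≡ y + (a + ni + na + i)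
    lhs = solve-∀
    rhs : ∀ i na ni iny a → i + na + ni + (iny + a) ≡ iny + (a + ni + na + i)
    rhs = solve-∀

  opaque
    matching : ∃[ f ] MatchingInto (Nbr I) I f
    matching = hall-theorem (Nbr I) I hallCondition

  f : Fin n → Fin n
  f = proj₁ matching

  f-into : ∀ y → Nbr I y ≡ true → I (f y) ≡ true
  f-into y NIy = proj₁ (proj₁ (proj₂ matching) y NIy)

  f-adj : ∀ y → Nbr I y ≡ true → adj G y (f y) ≡ true
  f-adj y NIy = proj₂ (proj₁ (proj₂ matching) y NIy)

  f-inj : ∀ y y′ → Nbr I y ≡ true → Nbr I y′ ≡ true → f y ≡ f y′ → y ≡ y′
  f-inj = proj₂ (proj₂ matching)

  closure : FSubset n
  closure = I ∪ Nbr I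

  closure-∉I : ∀ {t} → closure t ≡ true → I t ≡ false → Nbr I t ≡ true
  closure-∉I {t} Ct It = [ (λ It′ → ⊥-elim (bool-contradiction It′ It)) , (λ NIt → NIt) ]′ (∨-true⁻ {I t} Ct)

  -- Injects every independent subset of I ∪ N(I) into I.
  toI : Fin n → Fin n
  toI t = if I t then t else f t

  module IndependentInClosure (T : FSubset n) (T-ind : Independent T) (T⊆closure : T ⊆ closure) where

    toI-into : ∀ t → T t ≡ true → I (toI t) ≡ true
    toI-into t Tt with I t in It
    ... | true  = It
    ... | false = f-into t (closure-∉I (T⊆closure t Tt) It)

    toI-inj : ∀ t t′ → T t ≡ true → T t′ ≡ true → toI t ≡ toI t′ → t ≡ t′
    toI-inj t t′ Tt Tt′ e with I t in It | I t′ in It′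
    ... | true  | true  = e
    ... | false | false = f-inj t t′ (closure-∉I (T⊆closure t Tt) It) (closure-∉I (T⊆closure t′ Tt′) It′) e
    ... | true  | false = ⊥-elim (bool-contradiction
      (subst (λ x → adj G t′ x ≡ true) (sym e) (f-adj t′ (closure-∉I (T⊆closure t′ Tt′) It′)))
      (T-ind t′ t Tt′ Tt))
    ... | false | true  = ⊥-elim (bool-contradiction
      (subst (λ x → adj G t x ≡ true) e (f-adj t (closure-∉I (T⊆closure t Tt) It))) (T-ind t t′ Tt Tt′))

    |T|≤|I| : count T ≤ count I
    |T|≤|I| = count-≤-injection T I toI toI-into toI-inj

    module Extremal (|T|≡|I| : count T ≡ count I) where

      toI-onto : ∀ x → I x ≡ true → ∃[ t ] (T t ≡ true × toI t ≡ x)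
      toI-onto x Ix with FinP.any? (λ t → (T t ≟ᵇ true) ×-dec (toI t Fin.≟ x))
      ... | yes (t , Tt , t↦x) = t , Tt , t↦x
      ... | no ∄t = ⊥-elim (<-irrefl |T|≡|I|
        (count-<-injection T I toI toI-into toI-inj x Ix λ t Tt t↦x → ∄t (t , Tt , t↦x)))

      unmatched∈T : ∀ x → I x ≡ true → (∀ y → Nbr I y ≡ true → f y ≢ x) → T x ≡ true
      unmatched∈T x Ix unmatched with toI-onto x Ix
      ... | t , Tt , t↦x with I t in It
      ...   | true  = subst (λ z → T z ≡ true) t↦x Tt
      ...   | false = ⊥-elim (unmatched t (closure-∉I (T⊆closure t Tt) It) t↦x)

      matched-edge-meets-T : ∀ y → Nbr I y ≡ true → T y ≡ true ⊎ T (f y) ≡ true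
      matched-edge-meets-T y NIy with toI-onto (f y) (f-into y NIy)
      ... | t , Tt , t↦fy with I t in It
      ...   | true  = inj₂ (subst (λ z → T z ≡ true) t↦fy Tt)
      ...   | false = inj₁ (subst (λ z → T z ≡ true) (f-inj t y (closure-∉I (T⊆closure t Tt) It) NIy t↦fy) Tt)

  maxCritical⁻ : ∀ S → maxCriticalIndependent G S ≡ true → CriticalIndependent (lookup S) × count (lookup S) ≡ count I
  maxCritical⁻ S e = criticalIndependent⁻ S (∧-trueˡ e) ,
    trans (sym (∣∣≡count S))
          (trans (≡ᵇ⇒≡ _ _ (≡true⇒T (∧-trueʳ {criticalIndependent G S} e))) (sym |I|≡maxCritSize))

  maxCritical⊆closure : ∀ S → maxCriticalIndependent G S ≡ true → lookup S ⊆ closure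
  maxCritical⊆closure S e = criticalIndependent⊆∪Nbr I (lookup S) I-ci (proj₁ (maxCritical⁻ S e)) I-maximum

  diadem⁺ : ∀ S {v} → maxCriticalIndependent G S ≡ true → lookup S v ≡ true → lookup (diadem G) v ≡ true
  diadem⁺ S {v} S-max Sv = trans (lookup∘tabulate _ v)
    (any-≡true⁺ (λ S → maxCriticalIndependent G S ∧ lookup S v) (allSubsets n) (∈-allSubsets S) (∧-true⁺ S-max Sv))

  diadem⁻ : ∀ {v} → lookup (diadem G) v ≡ true → ∃[ S ] (maxCriticalIndependent G S ≡ true × lookup S v ≡ true)
  diadem⁻ {v} e with any-≡true⁻ (λ S → maxCriticalIndependent G S ∧ lookup S v) (allSubsets n)
                                 (trans (sym (lookup∘tabulate _ v)) e)
  ... | S , _ , S-max∧Sv = S , ∧-trueˡ S-max∧Sv , ∧-trueʳ {maxCriticalIndependent G S} S-max∧Sv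

  nucleus⁻ : ∀ {v} S → lookup (nucleus G) v ≡ true → maxCriticalIndependent G S ≡ true → lookup S v ≡ true
  nucleus⁻ {v} S e S-max = subst (λ b → not b ∨ lookup S v ≡ true) S-max
    (all-≡true⁻ (λ S → not (maxCriticalIndependent G S) ∨ lookup S v) (allSubsets n)
      (trans (sym (lookup∘tabulate _ v)) e) (∈-allSubsets S))

  ∉nucleus⁻ : ∀ {v} → lookup (nucleus G) v ≡ false → ∃[ S ] (maxCriticalIndependent G S ≡ true × lookup S v ≡ false)
  ∉nucleus⁻ {v} e with all-≡false⁻ (λ S → not (maxCriticalIndependent G S) ∨ lookup S v) (allSubsets n)
                                    (trans (sym (lookup∘tabulate _ v)) e)
  ... | S , _ , ¬max∨Sv≡false = let ¬max , Sv = ∨-false⁻ {not (maxCriticalIndependent G S)} ¬max∨Sv≡false in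
    S , ≢false⇒true (λ max → bool-contradiction (not-true⁺ max) ¬max) , Sv

  diadem⊆closure : lookup (diadem G) ⊆ closure
  diadem⊆closure v e = let S , S-max , Sv = diadem⁻ e in maxCritical⊆closure S S-max v Sv

  I⊆diadem : I ⊆ lookup (diadem G)
  I⊆diadem v Iv = diadem⁺ I′ I′-max Iv

  nucleus⊆I : lookup (nucleus G) ⊆ I
  nucleus⊆I v e = nucleus⁻ I′ e I′-max

  private
    D Nu : FSubset n
    D  = lookup (diadem G)
    Nu = lookup (nucleus G)

  |diadem|≡|I|+|diadem∩N[I]| : count D ≡ count I + count (D ∩ Nbr I)
  |diadem|≡|I|+|diadem∩N[I]| =
    trans (count-split D I) (cong₂ _+_ (count-cong (∩-≗ʳ D I I⊆diadem)) (count-cong D─I≗D∩NI))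
    where
    D─I≗D∩NI : D ─ I ≗ D ∩ Nbr I
    D─I≗D∩NI v with D v in Dv | I v in Iv
    ... | false | _     = refl
    ... | true  | true  = sym (independent⇒∉Nbr I-ind v Iv)
    ... | true  | false = sym (closure-∉I (diadem⊆closure v Dv) Iv)

  |I|≡|nucleus|+|I─nucleus| : count I ≡ count Nu + count (I ─ Nu)
  |I|≡|nucleus|+|I─nucleus| = trans (count-split I Nu) (cong (_+ count (I ─ Nu)) (count-cong (∩-≗ʳ I Nu nucleus⊆I)))

  -- f is a bijection from D ∩ N(I) to I ─ nucleus: a vertex of I missed by a maximum
  -- critical independent set S is matched, and S contains its partner.
  |diadem∩N[I]|≡|I─nucleus| : count (D ∩ Nbr I) ≡ count (I ─ Nu)
  |diadem∩N[I]|≡|I─nucleus| = ≤-antisym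
    (count-≤-injection (D ∩ Nbr I) (I ─ Nu) f
      (λ y e → ─-∈ I Nu (f-into y (∧-trueʳ {D y} e)) (f∉nucleus y e))
      (λ y y′ e e′ → f-inj y y′ (∧-trueʳ {D y} e) (∧-trueʳ {D y′} e′)))
    (count-≤-injectionᵈ (I ─ Nu) (D ∩ Nbr I) (λ x e → proj₁ (preimage x e))
      (λ x e → let _ , NIy , _ , Dy = preimage x e in ∧-true⁺ Dy NIy)
      (λ x x′ e e′ y≡y′ → trans (sym (proj₁ (proj₂ (proj₂ (preimage x e)))))
                           (trans (cong f y≡y′) (proj₁ (proj₂ (proj₂ (preimage x′ e′)))))))
    where
    f∉nucleus : ∀ y → (D ∩ Nbr I) y ≡ true → Nu (f y) ≡ false
    f∉nucleus y e = let S , S-max , Sy = diadem⁻ (∧-trueˡ e) in ≢true⇒false λ Nu-fy →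
      bool-contradiction (f-adj y (∧-trueʳ {D y} e))
        (proj₁ (proj₁ (maxCritical⁻ S S-max)) y (f y) Sy (nucleus⁻ S Nu-fy S-max))
    preimage : ∀ x → (I ─ Nu) x ≡ true → ∃[ y ] (Nbr I y ≡ true × f y ≡ x × D y ≡ true)
    preimage x e with ∉nucleus⁻ (─-∉ I Nu x e)
    ... | S , S-max , Sx with FinP.any? (λ y → (Nbr I y ≟ᵇ true) ×-dec (f y Fin.≟ x))
    ...   | yes (y , NIy , fy≡x) = y , NIy , fy≡x , diadem⁺ S S-max Sy
      where
      open IndependentInClosure (lookup S) (proj₁ (proj₁ (maxCritical⁻ S S-max))) (maxCritical⊆closure S S-max)
      open Extremal (proj₂ (maxCritical⁻ S S-max))
      Sy : lookup S y ≡ true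
      Sy = [ (λ Sy → Sy) , (λ Sfy → ⊥-elim (bool-contradiction (subst (λ z → lookup S z ≡ true) fy≡x Sfy) Sx)) ]′
             (matched-edge-meets-T y NIy)
    ...   | no ∄y = ⊥-elim (bool-contradiction (unmatched∈T x (─-⊆ I Nu x e) λ y NIy fy≡x → ∄y (y , NIy , fy≡x)) Sx)
      where
      open IndependentInClosure (lookup S) (proj₁ (proj₁ (maxCritical⁻ S S-max))) (maxCritical⊆closure S S-max)
      open Extremal (proj₂ (maxCritical⁻ S S-max))

  |diadem|+|nucleus|≡2|I| : count D + count Nu ≡ count I + count I
  |diadem|+|nucleus|≡2|I| = begin
    count D + count Nu                          ≡⟨ cong (_+ count Nu) |diadem|≡|I|+|diadem∩N[I]| ⟩
    (count I + count (D ∩ Nbr I)) + count Nu    ≡⟨ +-assoc (count I) _ (count Nu) ⟩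
    count I + (count (D ∩ Nbr I) + count Nu)    ≡⟨ cong (λ c → count I + (c + count Nu)) |diadem∩N[I]|≡|I─nucleus| ⟩
    count I + (count (I ─ Nu) + count Nu)
      ≡⟨ cong (count I +_) (trans (+-comm _ (count Nu)) (sym |I|≡|nucleus|+|I─nucleus|)) ⟩
    count I + count I                           ∎
    where open ≡-Reasoning

  matchedEdge : Edge → Bool
  matchedEdge (a , b) = (Nbr I a ∧ f a == b) ∨ (Nbr I b ∧ f b == a)

  matchedEdges : List Edge
  matchedEdges = filter (T? ∘ matchedEdge) (edges G)

  private
    N[I]∩I-empty : ∀ {w} → Nbr I w ≡ true → I w ≡ true → ⊥
    N[I]∩I-empty {w} NIw Iw = bool-contradiction NIw (independent⇒∉Nbr I-ind w Iw)

    matchedEdge⁻ : ∀ e → matchedEdge e ≡ true → ∃[ y ] (Nbr I y ≡ true × (e ≡ (y , f y) ⊎ e ≡ (f y , y)))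
    matchedEdge⁻ (a , b) e with ∨-true⁻ {Nbr I a ∧ f a == b} e
    ... | inj₁ p = a , ∧-trueˡ p , inj₁ (cong (a ,_) (sym (==⇒≡ (∧-trueʳ {Nbr I a} p))))
    ... | inj₂ p = b , ∧-trueˡ p , inj₂ (cong (_, b) (sym (==⇒≡ (∧-trueʳ {Nbr I b} p))))

    shared-end : ∀ {w y₁ y₂} → Nbr I y₁ ≡ true → Nbr I y₂ ≡ true →
      (w ≡ y₁ ⊎ w ≡ f y₁) → (w ≡ y₂ ⊎ w ≡ f y₂) → y₁ ≡ y₂
    shared-end NIy₁ NIy₂ (inj₁ refl) (inj₁ refl) = refl
    shared-end NIy₁ NIy₂ (inj₂ refl) (inj₂ e)    = f-inj _ _ NIy₁ NIy₂ e
    shared-end NIy₁ NIy₂ (inj₁ refl) (inj₂ refl) = ⊥-elim (N[I]∩I-empty NIy₁ (f-into _ NIy₂))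
    shared-end NIy₁ NIy₂ (inj₂ refl) (inj₁ refl) = ⊥-elim (N[I]∩I-empty NIy₂ (f-into _ NIy₁))

    ends-of : ∀ {w e y} → ends e w ≡ true → (e ≡ (y , f y) ⊎ e ≡ (f y , y)) → w ≡ y ⊎ w ≡ f y
    ends-of {w} w∈e (inj₁ refl) = ends⁻ {w} w∈e
    ends-of {w} w∈e (inj₂ refl) = [ inj₂ , inj₁ ]′ (ends⁻ {w} w∈e)

    incident-constant : ∀ w {e e′} → e ∈ incident w matchedEdges → e′ ∈ incident w matchedEdges → e ≡ e′
    incident-constant w {e} {e′} e∈ e′∈
      with ∈-filter⁻ (T? ∘ endpointOf G w) {xs = matchedEdges} e∈
         | ∈-filter⁻ (T? ∘ endpointOf G w) {xs = matchedEdges} e′∈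
    ... | e∈M , w∈e | e′∈M , w∈e′
      with ∈-filter⁻ (T? ∘ matchedEdge) {xs = edges G} e∈M | ∈-filter⁻ (T? ∘ matchedEdge) {xs = edges G} e′∈M
    ... | e∈E , e-matched | e′∈E , e′-matched
      with matchedEdge⁻ e (T⇒≡true e-matched) | matchedEdge⁻ e′ (T⇒≡true e′-matched)
    ... | y , NIy , e≡ | y′ , NIy′ , e′≡
      with shared-end NIy NIy′ (ends-of {w} (T⇒≡true w∈e) e≡) (ends-of {w} (T⇒≡true w∈e′) e′≡)
    ... | refl = same-orientation e≡ e′≡
      where
      same-orientation : (e ≡ (y , f y) ⊎ e ≡ (f y , y)) → (e′ ≡ (y , f y) ⊎ e′ ≡ (f y , y)) → e ≡ e′
      same-orientation (inj₁ p) (inj₁ q) = trans p (sym q)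
      same-orientation (inj₂ p) (inj₂ q) = trans p (sym q)
      same-orientation (inj₁ refl) (inj₂ refl) = ⊥-elim (FinP.<-asym (proj₁ (∈-edges⁻ e∈E)) (proj₁ (∈-edges⁻ e′∈E)))
      same-orientation (inj₂ refl) (inj₁ refl) = ⊥-elim (FinP.<-asym (proj₁ (∈-edges⁻ e∈E)) (proj₁ (∈-edges⁻ e′∈E)))

    orient : ∀ y → Dec (y Fin.< f y) → Edge
    orient y (yes _) = y , f y
    orient y (no _)  = f y , y

    orient-∈ : ∀ y → Nbr I y ≡ true → orient y (y Fin.<? f y) ∈ matchedEdges
    orient-∈ y NIy with y Fin.<? f y
    ... | yes y<fy = ∈-filter⁺ (T? ∘ matchedEdge) (∈-edges⁺ y<fy (f-adj y NIy))
                       (≡true⇒T (∨-trueˡ (∧-true⁺ NIy (==-refl (f y)))))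
    ... | no  y≮fy = ∈-filter⁺ (T? ∘ matchedEdge) (∈-edges⁺ fy<y (trans (adj-sym G (f y) y) (f-adj y NIy)))
                       (≡true⇒T (∨-trueʳ {Nbr I (f y) ∧ f (f y) == y} (∧-true⁺ NIy (==-refl (f y)))))
      where
      fy<y : f y Fin.< y
      fy<y = FinP.≤∧≢⇒< (≮⇒≥ y≮fy) λ fy≡y →
        N[I]∩I-empty NIy (subst (λ z → I z ≡ true) fy≡y (f-into y NIy))

    orient-injective : ∀ {y y′} d d′ → Nbr I y ≡ true → Nbr I y′ ≡ true →
      orient y d ≡ orient y′ d′ → y ≡ y′
    orient-injective (yes _) (yes _) _ _ e = cong proj₁ e
    orient-injective (no _)  (no _)  _ _ e = cong proj₂ e
    orient-injective (yes _) (no _)  NIy NIy′ e =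
      ⊥-elim (N[I]∩I-empty NIy (subst (λ z → I z ≡ true) (sym (cong proj₁ e)) (f-into _ NIy′)))
    orient-injective (no _)  (yes _) NIy NIy′ e =
      ⊥-elim (N[I]∩I-empty NIy′ (subst (λ z → I z ≡ true) (cong proj₁ e) (f-into _ NIy)))

  matchedEdges-matching : IsMatching matchedEdges
  matchedEdges-matching w = unique-constant⇒length≤1 (incident w matchedEdges)
    (UniqueP.filter⁺ _ (UniqueP.filter⁺ _ edges-unique)) (incident-constant w)

  |N[I]|≤μ : count (Nbr I) ≤ μ G
  |N[I]|≤μ = ≤-trans |N[I]|≤|matchedEdges|
    (μ-upper (filter∈sublists matchedEdge (edges G)) matchedEdges-matching)
    where
    |N[I]|≤|matchedEdges| : count (Nbr I) ≤ length matchedEdges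
    |N[I]|≤|matchedEdges| = subst (count (Nbr I) ≤_) (count-all {length matchedEdges})
      (count-≤-injectionᵈ (Nbr I) (λ _ → true) (λ y NIy → Any.index (orient-∈ y NIy)) (λ _ _ → refl)
        λ y y′ NIy NIy′ e → orient-injective _ _ NIy NIy′
          (SetoidMembership.index-injective (setoid Edge) (orient-∈ y NIy) (orient-∈ y′ NIy′) e))

  maxCritSize<α⇒diadem≢corona : maxCritSize G < α G → diadem G ≢ corona G
  maxCritSize<α⇒diadem≢corona c<α D≡C with α-attained
  ... | S′ , S′-ind , |S′|≡α = bool-contradiction (trans (cong (λ V → lookup V v) D≡C) corona-v) diadem-v
    where
    S S∩C : FSubset n
    S = lookup S′
    S∩C = S ∩ closure
    |S∩C|<|S| : count S∩C < count S
    |S∩C|<|S| = ≤-<-trans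
                (IndependentInClosure.|T|≤|I| S∩C
                  (λ u w Tu Tw → independent⁻ S′ S′-ind u w (∧-trueˡ Tu) (∧-trueˡ Tw))
                  (λ u → ∧-trueʳ {S u}))
                (subst₂ _<_ (sym |I|≡maxCritSize) (trans (sym |S′|≡α) (∣∣≡count S′)) c<α)
    outside : ∃[ v ] (S ─ closure) v ≡ true
    outside = count>0⇒∃ (S ─ closure) (+-cancelˡ-< (count S∩C) 0 _
      (subst₂ _<_ (sym (+-identityʳ (count S∩C))) (count-split S closure) |S∩C|<|S|))
    v : Fin n
    v = proj₁ outside
    diadem-v : lookup (diadem G) v ≡ false
    diadem-v = ≢true⇒false λ Dv → bool-contradiction (diadem⊆closure v Dv) (─-∉ S closure v (proj₂ outside))
    corona-v : lookup (corona G) v ≡ true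
    corona-v = trans (lookup∘tabulate _ v) (any-≡true⁺ (λ S → maxIndependent G S ∧ lookup S v) (allSubsets n)
      (∈-allSubsets S′)
      (∧-true⁺ (∧-true⁺ S′-ind (T⇒≡true (≡⇒≡ᵇ _ _ |S′|≡α))) (─-⊆ S closure v (proj₂ outside))))

  module MaxCritSize≡α (c≡α : maxCritSize G ≡ α G) where

    |I|≡α : count I ≡ α G
    |I|≡α = trans |I|≡maxCritSize c≡α

    maxCritical≡maxIndependent : ∀ S → maxCriticalIndependent G S ≡ maxIndependent G S
    maxCritical≡maxIndependent S = bool-ext to from
      where
      to : maxCriticalIndependent G S ≡ true → maxIndependent G S ≡ true
      to e = ∧-true⁺ (∧-trueˡ (∧-trueˡ e))
        (T⇒≡true (≡⇒≡ᵇ _ _ (trans (trans (∣∣≡count S) (proj₂ (maxCritical⁻ S e))) |I|≡α)))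
      from : maxIndependent G S ≡ true → maxCriticalIndependent G S ≡ true
      from e = ∧-true⁺ (criticalIndependent⁺ S (S-ind , S-critical))
        (T⇒≡true (≡⇒≡ᵇ _ _ (trans |S′|≡α (sym c≡α))))
        where
        S-ind : Independent (lookup S)
        S-ind = independent⁻ S (∧-trueˡ e)
        |S′|≡α : ∣ S ∣ ≡ α G
        |S′|≡α = ≡ᵇ⇒≡ _ _ (≡true⇒T (∧-trueʳ {independent G S} e))
        |S|≡α : count (lookup S) ≡ α G
        |S|≡α = trans (sym (∣∣≡count S)) |S′|≡α
        |NS|≡|NI| : count (Nbr (lookup S)) ≡ count (Nbr I)
        |NS|≡|NI| = +-cancelʳ-≡ (α G) _ _ (trans (count-Nbr-maxIndependent (lookup S) S-ind |S|≡α)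
                                                (sym (count-Nbr-maxIndependent I I-ind |I|≡α)))
        S-critical : Critical (lookup S)
        S-critical Z = subst₂ _≤_
          (cong (count Z +_) (sym |NS|≡|NI|)) (cong (_+ count (Nbr Z)) (trans |I|≡α (sym |S|≡α))) (proj₂ I-ci Z)

    diadem≡corona : diadem G ≡ corona G
    diadem≡corona = tabulate-cong λ v →
      any-cong (λ S → cong (_∧ lookup S v) (maxCritical≡maxIndependent S)) (allSubsets n)

    μ≡|N[I]| : μ G ≡ count (Nbr I)
    μ≡|N[I]| = ≤-antisym
      (μ-least (count (Nbr I)) λ {M} M∈ M-matching →
        subst (length M ≤_) (sym (count-cong (maxIndependent⇒Nbr≗∁ I I-ind |I|≡α)))
          (length≤count∁ M I (sublist-graphEdges M∈) M-matching I-ind))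
      |N[I]|≤μ

    könig-egerváry : KönigEgerváry G
    könig-egerváry = begin
      α G + μ G             ≡⟨ +-comm (α G) (μ G) ⟩
      μ G + α G             ≡⟨ cong (_+ α G) μ≡|N[I]| ⟩
      count (Nbr I) + α G   ≡⟨ count-Nbr-maxIndependent I I-ind |I|≡α ⟩
      n                     ∎
      where open ≡-Reasoning

  diadem≡corona⇒maxCritSize≡α : diadem G ≡ corona G → maxCritSize G ≡ α G
  diadem≡corona⇒maxCritSize≡α D≡C with maxCritSize G ≟ α G
  ... | yes c≡α = c≡α
  ... | no  c≢α = ⊥-elim (maxCritSize<α⇒diadem≢corona (≤∧≢⇒< maxCritSize≤α c≢α) D≡C)

  |diadem|+|nucleus|≡2c : ∣ diadem G ∣ + ∣ nucleus G ∣ ≡ 2 * maxCritSize G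
  |diadem|+|nucleus|≡2c = begin
    ∣ diadem G ∣ + ∣ nucleus G ∣      ≡⟨ cong₂ _+_ (∣∣≡count (diadem G)) (∣∣≡count (nucleus G)) ⟩
    count D + count Nu                ≡⟨ |diadem|+|nucleus|≡2|I| ⟩
    count I + count I
      ≡⟨ cong₂ _+_ |I|≡maxCritSize (trans |I|≡maxCritSize (sym (+-identityʳ _))) ⟩
    2 * maxCritSize G                 ∎
    where open ≡-Reasoning

theorem1p6 : ∀ {n : ℕ} (G : Graph n) →
    (KönigEgerváry G ⇔ (diadem G ≡ corona G)) ×
    (KönigEgerváry G ⇔ (∣ diadem G ∣ + ∣ nucleus G ∣ ≡ 2 * α G))
theorem1p6 G with Numbers.maxCritical-exists G
... | I′ , I′-max =
  mk⇔ (MaxCritSize≡α.diadem≡corona ∘ KönigEgerváry⇒maxCritSize≡α)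
      (MaxCritSize≡α.könig-egerváry ∘ diadem≡corona⇒maxCritSize≡α) ,
  mk⇔ (λ ke → trans |diadem|+|nucleus|≡2c (cong (2 *_) (KönigEgerváry⇒maxCritSize≡α ke)))
      (MaxCritSize≡α.könig-egerváry ∘ *-cancelˡ-≡ _ _ 2 ∘ trans (sym |diadem|+|nucleus|≡2c))
  where
  open KönigEgervárySets G
  open MaximumCritical G I′ I′-max
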